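{- For every fixed $\delta>0$ there exists a constant $C=C(\delta)$ such that with high probability the random graph $G\sim G(n,C/n)$ contains a tree $T$ (a subgraph of $G$) satisfying \[ |L(T)\cup L(I(T))| \ge \bigl(\tfrac59-\delta\bigr)n . \]
   Context: $G(n,p)$ denotes the binomial random graph on $n$ vertices, each pair joined independently with probability $p$. For a tree $T$, $L(T)$ is the set of leaves (vertices of degree $1$) of $T$; the inner tree $I(T)$ is the subgraph of $T$ induced by the non-leaf vertices of $T$, and $L(I(T))$ is the set of leaves of $I(T)$. "With high probability" means with probability tending to $1$ as $n\to\infty$.
   Formalization: The parameter δ ranges over the positive rationals, and the constant C is taken in the rationals. -}

module Defs where

open import Data.Bool using (Bool; true; false; _∧_; _∨_; if_then_else_)
open import Data.Nat as ℕ using (ℕ; zero; suc)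
open import Data.Fin using (Fin; _<?_)
open import Data.Fin.Properties using (_≟_)
open import Data.List using (List; []; _∷_; _++_; map; concatMap; filter; allFin; length; zip; foldr)
open import Data.List.Relation.Unary.Unique.Propositional using (Unique)
open import Data.List.Relation.Unary.All using (All)
open import Data.Product using (Σ; _×_; _,_)
open import Data.Unit using (⊤)
open import Data.Empty using (⊥)
open import Relation.Nullary using (¬_)
open import Relation.Nullary.Decidable using (⌊_⌋)
open import Relation.Binary.PropositionalEquality using (_≡_)
open import Data.Integer using (+_)
open import Data.Rational as ℚ using (ℚ; 0ℚ; 1ℚ; _/_)

-- Labelled simple graphs on the vertex set Fin n.
-- A graph is encoded by a bit list aligned with the list `pairs n` of all
-- vertex pairs (i , j) with i < j (bit true = the pair is an edge).

pairs : (n : ℕ) → List (Fin n × Fin n)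
pairs n = concatMap (λ i → map (i ,_) (filter (λ j → i <? j) (allFin n))) (allFin n)

numPairs : ℕ → ℕ
numPairs n = length (pairs n)

IsGraph : (n : ℕ) → List Bool → Set
IsGraph n g = length g ≡ numPairs n

eqF : {n : ℕ} → Fin n → Fin n → Bool
eqF i j = ⌊ i ≟ j ⌋

adj : {n : ℕ} → List Bool → Fin n → Fin n → Bool
adj {n} b i j = foldr (λ pb acc → step pb ∨ acc) false (zip (pairs n) b)
  where
  step : (Fin n × Fin n) × Bool → Bool
  step ((x , y) , bit) = bit ∧ ((eqF x i ∧ eqF y j) ∨ (eqF x j ∧ eqF y i))

count : {A : Set} → (A → Bool) → List A → ℕ
count P [] = 0
count P (x ∷ xs) = if P x then suc (count P xs) else count P xs

-- Trees as subgraphs.  A subgraph is given by a vertex set V and an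
-- edge bit list t (edges of t lie inside V and are edges of g).

Chain : {n : ℕ} → List Bool → List (Fin n) → Set
Chain t [] = ⊤
Chain t (x ∷ []) = ⊤
Chain t (x ∷ y ∷ r) = (adj t x y ≡ true) × Chain t (y ∷ r)

data Walk {n : ℕ} (t : List Bool) : Fin n → Fin n → Set where
  here : ∀ {i} → Walk t i i
  step : ∀ {i j k} → adj t i j ≡ true → Walk t j k → Walk t i k

HasCycle : {n : ℕ} → List Bool → Set
HasCycle {n} t =
  Σ (Fin n) λ x → Σ (List (Fin n)) λ xs →
    (2 ℕ.≤ length xs) × Unique (x ∷ xs) × Chain {n} t (x ∷ xs ++ x ∷ [])

IsSubtree : {n : ℕ} → List Bool → (Fin n → Bool) → List Bool → Set
IsSubtree {n} g V t =
  (Σ (Fin n) λ v → V v ≡ true)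
  × (∀ i j → adj t i j ≡ true → (V i ≡ true) × (V j ≡ true) × (adj g i j ≡ true))
  × (∀ i j → V i ≡ true → V j ≡ true → Walk {n} t i j)
  × ¬ HasCycle {n} t

deg : {n : ℕ} → List Bool → Fin n → ℕ
deg {n} t v = count (λ w → adj t v w) (allFin n)

isOne : ℕ → Bool
isOne (suc zero) = true
isOne _ = false

isLeafT : {n : ℕ} → (Fin n → Bool) → List Bool → Fin n → Bool
isLeafT V t v = V v ∧ isOne (deg t v)

isInner : {n : ℕ} → (Fin n → Bool) → List Bool → Fin n → Bool
isInner V t v = V v ∧ (if isOne (deg t v) then false else true)

-- v ∈ L(I(T)): v ∈ I(T) and v has exactly one neighbour in I(T)
-- (I(T) is the subgraph of T induced by the non-leaf vertices)
isLeafI : {n : ℕ} → (Fin n → Bool) → List Bool → Fin n → Bool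
isLeafI {n} V t v =
  isInner V t v ∧ isOne (count (λ w → adj t v w ∧ isInner V t w) (allFin n))

leafCount : {n : ℕ} → (Fin n → Bool) → List Bool → ℕ
leafCount {n} V t = count (λ v → isLeafT V t v ∨ isLeafI V t v) (allFin n)

HasManyLeafTree : (n : ℕ) → ℚ → List Bool → Set
HasManyLeafTree n δ g =
  Σ (Fin n → Bool) λ V → Σ (List Bool) λ t →
    IsSubtree g V t × ((+ 5 / 9 ℚ.- δ) ℚ.* (+ n / 1) ℚ.≤ (+ leafCount V t / 1))

-- The measure of G(n,p): weight of the graph g is p^e (1-p)^(N-e).

weight : ℚ → List Bool → ℚ
weight p [] = 1ℚ
weight p (b ∷ bs) = (if b then p else 1ℚ ℚ.- p) ℚ.* weight p bs

totalWeight : ℚ → List (List Bool) → ℚ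
totalWeight p gs = foldr (λ g acc → weight p g ℚ.+ acc) 0ℚ gs

-- 1/n (with the junk value 0 at n = 0, never used below since C ≤ n, C > 0)
inv : ℕ → ℚ
inv zero = 0ℚ
inv (suc m) = + 1 / suc m

-- P_{G(n,p)}[E] ≥ q, witnessed (as a finite sum) by a duplicate-free list of
-- graphs in the event E whose total probability is at least q.
ProbAtLeast : (n : ℕ) → ℚ → (List Bool → Set) → ℚ → Set
ProbAtLeast n p E q =
  Σ (List (List Bool)) λ S →
    Unique S × All (λ g → IsGraph n g × E g) S × (q ℚ.≤ totalWeight p S)

{-# OPTIONS --safe #-}
module Submission where

-- The leaves L(T) alone suffice: there is a tree with about 3n/5 of them. Put p = C/n with C = 2⁷⁵
-- and k = 5e, e = ⌊n/25⌋ + 1. For two fixed disjoint sets of k vertices the chance that no edge joins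
-- them is (1 - p)^(k²) ≤ ((1 - p)ⁿ)^e ≤ 2^(-75e), as Bernoulli's inequality gives (1 - p)ⁿ ≤ 1/(1 + C);
-- this beats the 4ⁿ pairs of sets, so with high probability any two disjoint k-sets are joined by an
-- edge. In such a graph, growing a tree one boundary vertex at a time from some vertex reaches k
-- vertices: otherwise every vertex lies in a closed set (no edge leaves it) of fewer than k vertices,
-- and adding these sets up one at a time yields a closed set with at least k vertices on each side.
-- Hanging every vertex adjacent to the k-vertex tree below it as a leaf leaves fewer than k vertices
-- unseen, so the tree has at least n - 2k ≥ 5n/9 leaves.

open import Defs
open import Data.Nat using (ℕ)
open import Data.Product using (Σ; _×_)
open import Data.Integer using (+_)
open import Data.Rational using (ℚ; 0ℚ; 1ℚ; _<_; _≤_; _-_; _*_; _/_)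

open import Data.Bool using (Bool; true; false; _∧_; _∨_; not; if_then_else_; T?)
import Data.Bool.Properties as Boolₚ
open import Data.Empty using (⊥; ⊥-elim)
open import Data.Fin using (Fin; _<?_) renaming (zero to fzero; suc to fsuc)
import Data.Fin.Properties as Finₚ
import Data.Integer as ℤ
import Data.Integer.Properties as ℤₚ
open import Data.List using (List; []; _∷_; _++_; map; filter; filterᵇ; allFin; length; zip; foldr; tabulate; cartesianProduct)
import Data.List.Properties as LP
open import Data.List.Membership.Propositional using (_∈_)
open import Data.List.Membership.Propositional.Properties
  using (∈-map⁺; ∈-map⁻; ∈-filter⁺; ∈-concat⁺′; ∈-allFin; ∈-++⁺ˡ; ∈-++⁺ʳ; ∈-cartesianProduct⁺)
open import Data.List.Relation.Unary.Any using (here; there)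
open import Data.List.Relation.Unary.All as All using (All; []; _∷_)
import Data.List.Relation.Unary.All.Properties as Allₚ
open import Data.List.Relation.Unary.AllPairs using ([]; _∷_)
import Data.List.Relation.Unary.AllPairs.Properties as AllPairsₚ
open import Data.List.Relation.Unary.Unique.Propositional using (Unique)
import Data.List.Relation.Unary.Unique.Propositional.Properties as Uniqueₚ
open import Data.Nat as ℕ using (zero; suc; _+_; _∸_; z≤n; s≤s)
  renaming (_≤_ to _≤ₙ_; _<_ to _<ₙ_; _*_ to _*ₙ_)
import Data.Nat.Coprimality as Coprimality
import Data.Nat.DivMod as DivMod
import Data.Nat.Properties as ℕₚ
import Data.Nat.Solver as ℕSolver
open import Data.Product using (_,_; proj₁; proj₂; ∃)
open import Data.Rational using (mkℚ; *≤*; *<*; 1/_; positive; nonNegative) renaming (_+_ to _+ℚ_)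
import Data.Rational.Properties as ℚₚ
open import Data.Rational.Solver using (module +-*-Solver)
open import Data.Sum using (_⊎_; inj₁; inj₂)
open import Data.Unit using (⊤; tt)
open import Data.Vec.Functional using () renaming (_∷_ to _∷ᶠ_)
open import Function using (_∘_)
open import Function.Bundles using (Equivalence)
open import Relation.Binary using (tri<; tri≈; tri>)
open import Relation.Binary.PropositionalEquality
  using (_≡_; _≢_; refl; sym; trans; cong; cong₂; subst; subst₂; _≗_; module ≡-Reasoning)
open import Relation.Nullary using (¬_; Dec; yes; no; does)
open import Relation.Nullary.Decidable using (_×-dec_; dec-true)
open import Algebra.Bundles using (CommutativeRing)
open import Algebra.Properties.CommutativeMonoid.Sum ℕₚ.+-0-commutativeMonoid
  using (sum-syntax; ∑-distrib-+; sum-cong-≗)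
open import Algebra.Properties.CommutativeSemiring.Exp (CommutativeRing.commutativeSemiring ℚₚ.+-*-commutativeRing)
  using (_^_; ^-distrib-*; ^-assocʳ)

variable
  n : ℕ

true≢false : ∀ {b} → b ≡ true → b ≢ false
true≢false refl ()

∧-true⁻ : ∀ {a b} → a ∧ b ≡ true → a ≡ true × b ≡ true
∧-true⁻ {true} {true} refl = refl , refl

∨-true⁻ : ∀ a {b} → a ∨ b ≡ true → a ≡ true ⊎ b ≡ true
∨-true⁻ true  _ = inj₁ refl
∨-true⁻ false p = inj₂ p

not-true⁻ : ∀ {a} → not a ≡ true → a ≡ false
not-true⁻ {false} refl = refl

does-true⁻ : {A : Set} (a? : Dec A) → does a? ≡ true → A
does-true⁻ (yes a) _ = a

eqF-refl : (i : Fin n) → eqF i i ≡ true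
eqF-refl i with i Finₚ.≟ i
... | yes _  = refl
... | no i≢i = ⊥-elim (i≢i refl)

eqF-true⁻ : {i j : Fin n} → eqF i j ≡ true → i ≡ j
eqF-true⁻ {i = i} {j} p with i Finₚ.≟ j
... | yes i≡j = i≡j

eqF-false : {i j : Fin n} → i ≢ j → eqF i j ≡ false
eqF-false {i = i} {j} i≢j with i Finₚ.≟ j
... | yes i≡j = ⊥-elim (i≢j i≡j)
... | no _    = refl

𝟙 : Bool → ℕ
𝟙 true  = 1
𝟙 false = 0

card : (Fin n → Bool) → ℕ
card {n} X = count X (allFin n)

card≡∑ : (X : Fin n → Bool) → card X ≡ ∑[ i < n ] 𝟙 (X i)
card≡∑ {n} X = count-tabulate (λ i → i)
  where
  count-tabulate : ∀ {m} (g : Fin m → Fin n) → count X (tabulate g) ≡ ∑[ i < m ] 𝟙 (X (g i))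
  count-tabulate {zero}  g = refl
  count-tabulate {suc m} g with X (g fzero)
  ... | true  = cong suc (count-tabulate (g ∘ fsuc))
  ... | false = count-tabulate (g ∘ fsuc)

∑-mono : {f g : Fin n → ℕ} → (∀ i → f i ≤ₙ g i) → ∑[ i < n ] f i ≤ₙ ∑[ i < n ] g i
∑-mono {zero}  f≤g = z≤n
∑-mono {suc n} f≤g = ℕₚ.+-mono-≤ (f≤g fzero) (∑-mono (f≤g ∘ fsuc))

∑-zero : ∑[ i < n ] 0 ≡ 0
∑-zero {zero}  = refl
∑-zero {suc n} = ∑-zero {n}

∑-one : ∑[ i < n ] 1 ≡ n
∑-one {zero}  = refl
∑-one {suc n} = cong suc (∑-one {n})

card-cong : {X Y : Fin n → Bool} → X ≗ Y → card X ≡ card Y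
card-cong {X = X} {Y} X≗Y =
  trans (card≡∑ X) (trans (sum-cong-≗ (cong 𝟙 ∘ X≗Y)) (sym (card≡∑ Y)))

card-mono : {X Y : Fin n → Bool} → (∀ i → X i ≡ true → Y i ≡ true) → card X ≤ₙ card Y
card-mono {X = X} {Y} X⊆Y =
  subst₂ _≤ₙ_ (sym (card≡∑ X)) (sym (card≡∑ Y)) (∑-mono (λ i → 𝟙-mono (X⊆Y i)))
  where
  𝟙-mono : ∀ {a b} → (a ≡ true → b ≡ true) → 𝟙 a ≤ₙ 𝟙 b
  𝟙-mono {false} _   = z≤n
  𝟙-mono {true}  a⇒b rewrite a⇒b refl = ℕₚ.≤-refl

card-empty : (X : Fin n → Bool) → (∀ i → X i ≡ false) → card X ≡ 0
card-empty {n} X X≡∅ = trans (card≡∑ X) (trans (sum-cong-≗ (cong 𝟙 ∘ X≡∅)) (∑-zero {n}))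

card-full : (X : Fin n → Bool) → (∀ i → X i ≡ true) → card X ≡ n
card-full {n} X X≡⊤ = trans (card≡∑ X) (trans (sum-cong-≗ (cong 𝟙 ∘ X≡⊤)) (∑-one {n}))

card-singleton : (X : Fin n → Bool) (u : Fin n) → X u ≡ true → (∀ i → X i ≡ true → i ≡ u) → card X ≡ 1
card-singleton X u Xu X⊆u = trans (card≡∑ X) (∑𝟙-singleton X u Xu X⊆u)
  where
  ∑𝟙-singleton : ∀ {m} (X : Fin m → Bool) (u : Fin m) → X u ≡ true → (∀ i → X i ≡ true → i ≡ u) →
                 ∑[ i < m ] 𝟙 (X i) ≡ 1
  ∑𝟙-singleton {suc m} X fzero Xu X⊆u rewrite Xu =
    cong suc (trans (sum-cong-≗ (cong 𝟙 ∘ rest-empty)) (∑-zero {m}))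
    where
    rest-empty : ∀ i → X (fsuc i) ≡ false
    rest-empty i with X (fsuc i) in Xi
    ... | false = refl
    ... | true  with X⊆u (fsuc i) Xi
    ...   | ()
  ∑𝟙-singleton X (fsuc u) Xu X⊆u with X fzero in X0
  ... | true  with X⊆u fzero X0
  ...   | ()
  ∑𝟙-singleton X (fsuc u) Xu X⊆u | false =
    ∑𝟙-singleton (X ∘ fsuc) u Xu (λ i Xi → Finₚ.suc-injective (X⊆u (fsuc i) Xi))

card-point : (u : Fin n) → card (λ i → eqF i u) ≡ 1
card-point u = card-singleton (λ i → eqF i u) u (eqF-refl u) (λ i → eqF-true⁻)

card-∨+card-∧ : (X Y : Fin n → Bool) → card (λ i → X i ∨ Y i) + card (λ i → X i ∧ Y i) ≡ card X + card Y
card-∨+card-∧ {n} X Y = begin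
    card (λ i → X i ∨ Y i) + card (λ i → X i ∧ Y i)
  ≡⟨ cong₂ _+_ (card≡∑ (λ i → X i ∨ Y i)) (card≡∑ (λ i → X i ∧ Y i)) ⟩
    ∑[ i < n ] 𝟙 (X i ∨ Y i) + ∑[ i < n ] 𝟙 (X i ∧ Y i)
  ≡⟨ sym (∑-distrib-+ (λ i → 𝟙 (X i ∨ Y i)) (λ i → 𝟙 (X i ∧ Y i))) ⟩
    ∑[ i < n ] (𝟙 (X i ∨ Y i) + 𝟙 (X i ∧ Y i))
  ≡⟨ sum-cong-≗ (λ i → 𝟙-∨+𝟙-∧ (X i) (Y i)) ⟩
    ∑[ i < n ] (𝟙 (X i) + 𝟙 (Y i))
  ≡⟨ ∑-distrib-+ (𝟙 ∘ X) (𝟙 ∘ Y) ⟩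
    ∑[ i < n ] 𝟙 (X i) + ∑[ i < n ] 𝟙 (Y i)
  ≡⟨ sym (cong₂ _+_ (card≡∑ X) (card≡∑ Y)) ⟩
    card X + card Y ∎
  where
  open ≡-Reasoning
  𝟙-∨+𝟙-∧ : ∀ a b → 𝟙 (a ∨ b) + 𝟙 (a ∧ b) ≡ 𝟙 a + 𝟙 b
  𝟙-∨+𝟙-∧ true  true  = refl
  𝟙-∨+𝟙-∧ true  false = refl
  𝟙-∨+𝟙-∧ false true  = refl
  𝟙-∨+𝟙-∧ false false = refl

card-∨ : (X Y : Fin n → Bool) → card (λ i → X i ∨ Y i) ≤ₙ card X + card Y
card-∨ X Y = subst (card (λ i → X i ∨ Y i) ≤ₙ_) (card-∨+card-∧ X Y) (ℕₚ.m≤m+n _ _)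

card-complement : (X : Fin n → Bool) → card X + card (not ∘ X) ≡ n
card-complement {n} X = begin
  card X + card (not ∘ X)                                           ≡⟨ sym (card-∨+card-∧ X (not ∘ X)) ⟩
  card (λ i → X i ∨ not (X i)) + card (λ i → X i ∧ not (X i))        ≡⟨ cong₂ _+_ full empty ⟩
  n + 0                                                             ≡⟨ ℕₚ.+-identityʳ n ⟩
  n                                                                 ∎
  where
  open ≡-Reasoning
  full  = card-full _ (λ i → Boolₚ.∨-inverseʳ (X i))
  empty = card-empty _ (λ i → Boolₚ.∧-inverseʳ (X i))

card-partition₃ : (X Y Z : Fin n → Bool) → (∀ i → 𝟙 (X i) + 𝟙 (Y i) + 𝟙 (Z i) ≡ 1) →
                  card X + card Y + card Z ≡ n
card-partition₃ {n} X Y Z one = begin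
    card X + card Y + card Z
  ≡⟨ cong₂ _+_ (cong₂ _+_ (card≡∑ X) (card≡∑ Y)) (card≡∑ Z) ⟩
    ∑[ i < n ] 𝟙 (X i) + ∑[ i < n ] 𝟙 (Y i) + ∑[ i < n ] 𝟙 (Z i)
  ≡⟨ cong (_+ ∑[ i < n ] 𝟙 (Z i)) (sym (∑-distrib-+ (𝟙 ∘ X) (𝟙 ∘ Y))) ⟩
    ∑[ i < n ] (𝟙 (X i) + 𝟙 (Y i)) + ∑[ i < n ] 𝟙 (Z i)
  ≡⟨ sym (∑-distrib-+ (λ i → 𝟙 (X i) + 𝟙 (Y i)) (𝟙 ∘ Z)) ⟩
    ∑[ i < n ] (𝟙 (X i) + 𝟙 (Y i) + 𝟙 (Z i))
  ≡⟨ trans (sum-cong-≗ one) (∑-one {n}) ⟩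
    n ∎
  where open ≡-Reasoning

anyᵇ : {A : Set} → (A → Bool) → List A → Bool
anyᵇ f = foldr (λ a acc → f a ∨ acc) false

anyᵇ-true⁺ : {A : Set} (f : A → Bool) {xs : List A} {a : A} → a ∈ xs → f a ≡ true → anyᵇ f xs ≡ true
anyᵇ-true⁺ f (here refl) fa rewrite fa = refl
anyᵇ-true⁺ f {x ∷ xs} (there a∈xs) fa rewrite anyᵇ-true⁺ f a∈xs fa = Boolₚ.∨-zeroʳ (f x)

anyᵇ-true⁻ : {A : Set} (f : A → Bool) (xs : List A) → anyᵇ f xs ≡ true → ∃ λ a → a ∈ xs × f a ≡ true
anyᵇ-true⁻ f (x ∷ xs) p with f x in fx
... | true  = x , here refl , fx
... | false with anyᵇ-true⁻ f xs p
...   | a , a∈xs , fa = a , there a∈xs , fa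

anyᵇ-cong : {A : Set} {f g : A → Bool} → f ≗ g → anyᵇ f ≗ anyᵇ g
anyᵇ-cong f≗g []       = refl
anyᵇ-cong f≗g (x ∷ xs) = cong₂ _∨_ (f≗g x) (anyᵇ-cong f≗g xs)

-- The step of the fold defining adj, so that adj b i j is anyᵇ (joins i j) (zip (pairs n) b).
joins : {n : ℕ} → Fin n → Fin n → (Fin n × Fin n) × Bool → Bool
joins i j ((x , y) , bit) = bit ∧ ((eqF x i ∧ eqF y j) ∨ (eqF x j ∧ eqF y i))

joins-sym : (i j : Fin n) → joins i j ≗ joins j i
joins-sym i j ((x , y) , bit) = cong (bit ∧_) (Boolₚ.∨-comm (eqF x i ∧ eqF y j) (eqF x j ∧ eqF y i))

joins-true⁻ : {i j x y : Fin n} {bit : Bool} → joins i j ((x , y) , bit) ≡ true →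
              bit ≡ true × ((x ≡ i × y ≡ j) ⊎ (x ≡ j × y ≡ i))
joins-true⁻ {i = i} {j} {x} {y} {bit} p with ∧-true⁻ {bit} p
... | bit≡true , ends with ∨-true⁻ (eqF x i ∧ eqF y j) ends
...   | inj₁ xi∧yj = bit≡true , inj₁ (eqF-true⁻ (proj₁ (∧-true⁻ xi∧yj)) , eqF-true⁻ (proj₂ (∧-true⁻ xi∧yj)))
...   | inj₂ xj∧yi = bit≡true , inj₂ (eqF-true⁻ (proj₁ (∧-true⁻ xj∧yi)) , eqF-true⁻ (proj₂ (∧-true⁻ xj∧yi)))

adj-sym : (b : List Bool) (i j : Fin n) → adj b i j ≡ adj b j i
adj-sym {n} b i j = anyᵇ-cong (joins-sym i j) (zip (pairs n) b)

adj-bit : (b : List Bool) {x y : Fin n} → ((x , y) , true) ∈ zip (pairs n) b → adj b x y ≡ true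
adj-bit {n} b {x} {y} xy∈b = anyᵇ-true⁺ (joins x y) xy∈b joins-xy
  where
  joins-xy : joins x y ((x , y) , true) ≡ true
  joins-xy rewrite eqF-refl x | eqF-refl y = refl

pairs-∈ : {i j : Fin n} → i Data.Fin.< j → (i , j) ∈ pairs n
pairs-∈ {n} {i} {j} i<j =
  ∈-concat⁺′ (∈-map⁺ (i ,_) (∈-filter⁺ (i <?_) (∈-allFin j) i<j))
             (∈-map⁺ (λ i → map (i ,_) (filter (i <?_) (allFin n))) (∈-allFin i))

Symmetric : (Fin n → Fin n → Bool) → Set
Symmetric E = ∀ x y → E x y ≡ E y x

edgeBits : (Fin n → Fin n → Bool) → List Bool
edgeBits {n} E = map (λ (x , y) → E x y) (pairs n)

zip-edgeBits : (E : Fin n → Fin n → Bool) →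
               zip (pairs n) (edgeBits E) ≡ map (λ (x , y) → ((x , y) , E x y)) (pairs n)
zip-edgeBits {n} E = zip-map (pairs n)
  where
  zip-map : (ps : List (Fin n × Fin n)) → zip ps (map (λ (x , y) → E x y) ps) ≡ map (λ (x , y) → ((x , y) , E x y)) ps
  zip-map []       = refl
  zip-map (p ∷ ps) = cong (_ ∷_) (zip-map ps)

adj-edgeBits⁻ : (E : Fin n → Fin n → Bool) → Symmetric E →
                ∀ i j → adj (edgeBits E) i j ≡ true → E i j ≡ true
adj-edgeBits⁻ {n} E E-sym i j ij rewrite zip-edgeBits E
  with anyᵇ-true⁻ (joins i j) _ ij
... | _ , a∈ , joins-a with ∈-map⁻ (λ (x , y) → ((x , y) , E x y)) {xs = pairs n} a∈
...   | (x , y) , _ , refl with joins-true⁻ {i = i} {j} {x} {y} joins-a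
...     | Exy , inj₁ (refl , refl) = Exy
...     | Exy , inj₂ (refl , refl) = trans (E-sym i j) Exy

edgeBits-∈ : (E : Fin n → Fin n → Bool) {x y : Fin n} → x Data.Fin.< y → E x y ≡ true →
             ((x , y) , true) ∈ zip (pairs n) (edgeBits E)
edgeBits-∈ {n} E {x} {y} x<y Exy rewrite zip-edgeBits E =
  subst (λ b → ((x , y) , b) ∈ map (λ (x , y) → ((x , y) , E x y)) (pairs n)) Exy
        (∈-map⁺ (λ (x , y) → ((x , y) , E x y)) (pairs-∈ x<y))

adj-edgeBits⁺ : (E : Fin n → Fin n → Bool) → Symmetric E →
                ∀ i j → i ≢ j → E i j ≡ true → adj (edgeBits E) i j ≡ true
adj-edgeBits⁺ E E-sym i j i≢j Eij with Finₚ.<-cmp i j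
... | tri< i<j _ _ = adj-bit (edgeBits E) (edgeBits-∈ E i<j Eij)
... | tri≈ _ i≡j _ = ⊥-elim (i≢j i≡j)
... | tri> _ _ j<i =
  trans (adj-sym (edgeBits E) i j) (adj-bit (edgeBits E) (edgeBits-∈ E j<i (trans (E-sym j i) Eij)))

-- Trees given by parent pointers with decreasing ranks

walk-snoc : {t : List Bool} {i j k : Fin n} → Walk t i j → adj t j k ≡ true → Walk t i k
walk-snoc here           jk = step jk here
walk-snoc (step ij walk) jk = step ij (walk-snoc walk jk)

walk-reverse : {t : List Bool} {i j : Fin n} → Walk t i j → Walk t j i
walk-reverse         here                    = here
walk-reverse {t = t} (step {i} {j} ij walk) = walk-snoc (walk-reverse walk) (trans (adj-sym t j i) ij)

walk-++ : {t : List Bool} {i j k : Fin n} → Walk t i j → Walk t j k → Walk t i k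
walk-++ here           walk′ = walk′
walk-++ (step ij walk) walk′ = step ij (walk-++ walk walk′)

NonBacktracking : {A : Set} → List A → Set
NonBacktracking (a ∷ b ∷ c ∷ r) = a ≢ c × NonBacktracking (b ∷ c ∷ r)
NonBacktracking _               = ⊤

unique⇒nonBacktracking : {A : Set} (l : List A) → Unique l → NonBacktracking l
unique⇒nonBacktracking []              _                            = tt
unique⇒nonBacktracking (a ∷ [])        _                            = tt
unique⇒nonBacktracking (a ∷ b ∷ [])    _                            = tt
unique⇒nonBacktracking (a ∷ b ∷ c ∷ r) ((_ ∷ a≢c ∷ _) ∷ unique-bcr) =
  a≢c , unique⇒nonBacktracking (b ∷ c ∷ r) unique-bcr

lastOr : {A : Set} → A → List A → A
lastOr d []       = d
lastOr d (x ∷ xs) = lastOr x xs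

lastOr-∷ʳ : {A : Set} (d : A) (l : List A) (x : A) → lastOr d (l ++ x ∷ []) ≡ x
lastOr-∷ʳ d []      x = refl
lastOr-∷ʳ d (y ∷ l) x = lastOr-∷ʳ y l x

lastOr-∈ : {A : Set} (d z : A) (l : List A) → lastOr d (z ∷ l) ∈ z ∷ l
lastOr-∈ d z []      = here refl
lastOr-∈ d z (w ∷ l) = there (lastOr-∈ z w l)

record ParentTree (g : List Bool) (r : Fin n) : Set where
  field
    V         : Fin n → Bool
    parent    : Fin n → Fin n
    rank      : Fin n → ℕ
    root∈V    : V r ≡ true
    parent-ok : ∀ v → V v ≡ true → v ≢ r →
                V (parent v) ≡ true × rank (parent v) <ₙ rank v × adj g v (parent v) ≡ true

module ParentTreeProperties {g : List Bool} {r : Fin n} (P : ParentTree g r) where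
  open ParentTree P

  Child : Fin n → Fin n → Bool
  Child x y = V x ∧ not (eqF x r) ∧ eqF (parent x) y

  edges : List Bool
  edges = edgeBits (λ x y → Child x y ∨ Child y x)

  Child⁻ : ∀ {x y} → Child x y ≡ true → V x ≡ true × x ≢ r × parent x ≡ y
  Child⁻ {x} p with ∧-true⁻ {V x} p
  ... | x∈V , q with ∧-true⁻ {not (eqF x r)} q
  ...   | x≢r , px≡y = x∈V , (λ { refl → true≢false x≢r (cong not (eqF-refl r)) }) , eqF-true⁻ px≡y

  Child⁺ : ∀ {x} → V x ≡ true → x ≢ r → Child x (parent x) ≡ true
  Child⁺ {x} x∈V x≢r rewrite x∈V | eqF-false x≢r | eqF-refl (parent x) = refl

  Child-rank : ∀ {x y} → Child x y ≡ true → rank y <ₙ rank x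
  Child-rank p with Child⁻ p
  ... | x∈V , x≢r , refl = proj₁ (proj₂ (parent-ok _ x∈V x≢r))

  Child-functional : ∀ {x y z} → Child x y ≡ true → Child x z ≡ true → y ≡ z
  Child-functional p q = trans (sym (proj₂ (proj₂ (Child⁻ p)))) (proj₂ (proj₂ (Child⁻ q)))

  adj-edges⁻ : ∀ {i j} → adj edges i j ≡ true → Child i j ≡ true ⊎ Child j i ≡ true
  adj-edges⁻ {i} {j} p = ∨-true⁻ (Child i j) (adj-edgeBits⁻ _ (λ x y → Boolₚ.∨-comm (Child x y) _) i j p)

  adj-edges⁺ : ∀ {i j} → Child i j ≡ true → adj edges i j ≡ true
  adj-edges⁺ {i} {j} p = adj-edgeBits⁺ _ (λ x y → Boolₚ.∨-comm (Child x y) _) i j i≢j (cong (_∨ Child j i) p)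
    where
    i≢j : i ≢ j
    i≢j refl = ℕₚ.<-irrefl refl (Child-rank p)

  edges-inside : ∀ i j → adj edges i j ≡ true → V i ≡ true × V j ≡ true × adj g i j ≡ true
  edges-inside i j p with adj-edges⁻ p
  ... | inj₁ i→j with Child⁻ i→j
  ...   | i∈V , i≢r , refl = i∈V , proj₁ (parent-ok i i∈V i≢r) , proj₂ (proj₂ (parent-ok i i∈V i≢r))
  edges-inside i j p | inj₂ j→i with Child⁻ j→i
  ...   | j∈V , j≢r , refl =
    proj₁ (parent-ok j j∈V j≢r) , j∈V , trans (adj-sym g i j) (proj₂ (proj₂ (parent-ok j j∈V j≢r)))

  walk-to-root : ∀ m v → rank v <ₙ m → V v ≡ true → Walk edges v r
  walk-to-root (suc m) v rv<m v∈V with v Finₚ.≟ r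
  ... | yes refl = here
  ... | no  v≢r  = step (adj-edges⁺ (Child⁺ v∈V v≢r))
                        (walk-to-root m (parent v) (ℕₚ.<-≤-trans rpv<rv (ℕₚ.≤-pred rv<m)) pv∈V)
    where
    pv∈V   = proj₁ (parent-ok v v∈V v≢r)
    rpv<rv = proj₁ (proj₂ (parent-ok v v∈V v≢r))

  connected : ∀ i j → V i ≡ true → V j ≡ true → Walk edges i j
  connected i j i∈V j∈V =
    walk-++ (walk-to-root _ i ℕₚ.≤-refl i∈V) (walk-reverse (walk-to-root _ j ℕₚ.≤-refl j∈V))

  LastStepDown : List (Fin n) → Set
  LastStepDown (a ∷ b ∷ [])    = Child b a ≡ true
  LastStepDown (a ∷ b ∷ c ∷ l) = LastStepDown (b ∷ c ∷ l)
  LastStepDown _               = ⊥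

  lastStepDown-∷ʳ : ∀ a l x → LastStepDown (a ∷ l ++ x ∷ []) → Child x (lastOr a l) ≡ true
  lastStepDown-∷ʳ a []          x p = p
  lastStepDown-∷ʳ a (b ∷ [])    x p = p
  lastStepDown-∷ʳ a (b ∷ c ∷ l) x p = lastStepDown-∷ʳ b (c ∷ l) x p

  -- Once a non-backtracking chain steps down from a parent to a child it can only keep going
  -- down, because the parent of the child is the vertex it just left.
  descending : ∀ a b l → Chain edges (a ∷ b ∷ l) → NonBacktracking (a ∷ b ∷ l) → Child b a ≡ true →
               rank a <ₙ rank (lastOr b l) × LastStepDown (a ∷ b ∷ l)
  descending a b []      _           _          b→a = Child-rank b→a , b→a
  descending a b (c ∷ l) (_ , chain) (a≢c , nb) b→a with adj-edges⁻ (proj₁ chain)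
  ... | inj₁ b→c = ⊥-elim (a≢c (Child-functional b→a b→c))
  ... | inj₂ c→b with descending b c l chain nb c→b
  ...   | rb<rlast , down = ℕₚ.<-trans (Child-rank b→a) rb<rlast , down

  ascending-or-down : ∀ a b l → Chain edges (a ∷ b ∷ l) → NonBacktracking (a ∷ b ∷ l) →
                      rank (lastOr b l) <ₙ rank a ⊎ LastStepDown (a ∷ b ∷ l)
  ascending-or-down a b l chain nb with adj-edges⁻ (proj₁ chain)
  ... | inj₂ b→a = inj₂ (proj₂ (descending a b l chain nb b→a))
  ascending-or-down a b []      chain       nb       | inj₁ a→b = inj₁ (Child-rank a→b)
  ascending-or-down a b (c ∷ l) (_ , chain) (_ , nb) | inj₁ a→b with ascending-or-down b c l chain nb
  ... | inj₁ rlast<rb = inj₁ (ℕₚ.<-trans rlast<rb (Child-rank a→b))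
  ... | inj₂ down     = inj₂ down

  -- On a cycle x x₁ … xₖ x that first goes up and finally comes down, both x₁ and xₖ are the parent of x.
  acyclic : ¬ HasCycle edges
  acyclic (x , [] , () , _)
  acyclic (x , x₁ ∷ [] , s≤s () , _)
  acyclic (x , x₁ ∷ x₂ ∷ l , _ , (x≢x₁ ∷ x≢x₂ ∷ x≢l) ∷ unique-x₁x₂l@(x₁≢x₂l ∷ _) , chain) =
    contradiction (ascending-or-down x x₁ rest chain nonBacktracking) (adj-edges⁻ (proj₁ chain))
    where
    rest : List (Fin n)
    rest = x₂ ∷ l ++ x ∷ []

    last≡x : lastOr x₁ rest ≡ x
    last≡x = lastOr-∷ʳ x₁ (x₂ ∷ l) x

    nonBacktracking : NonBacktracking (x ∷ x₁ ∷ rest)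
    nonBacktracking = x≢x₂ , unique⇒nonBacktracking (x₁ ∷ rest)
      (AllPairsₚ.++⁺ unique-x₁x₂l ([] ∷ [])
                     (All.map (λ x≢a → (λ a≡x → x≢a (sym a≡x)) ∷ []) (x≢x₁ ∷ x≢x₂ ∷ x≢l)))

    contradiction : rank (lastOr x₁ rest) <ₙ rank x ⊎ LastStepDown (x ∷ x₁ ∷ rest) →
                    Child x x₁ ≡ true ⊎ Child x₁ x ≡ true → ⊥
    contradiction (inj₁ rx<rx) _          = ℕₚ.<-irrefl (cong rank last≡x) rx<rx
    contradiction (inj₂ _)     (inj₂ x₁→x) =
      ℕₚ.<-irrefl (cong rank (sym last≡x)) (proj₁ (descending x x₁ rest chain nonBacktracking x₁→x))
    contradiction (inj₂ down)  (inj₁ x→x₁) =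
      Allₚ.All¬⇒¬Any x₁≢x₂l (subst (_∈ x₂ ∷ l) (Child-functional (lastStepDown-∷ʳ x (x₁ ∷ x₂ ∷ l) x down) x→x₁)
                                         (lastOr-∈ x₁ x₂ l))

  isSubtree : IsSubtree g V edges
  isSubtree = (r , root∈V) , edges-inside , connected , acyclic

  leaf : ∀ x → V x ≡ true → x ≢ r → (∀ y → V y ≡ true → y ≢ r → parent y ≢ x) → isLeafT V edges x ≡ true
  leaf x x∈V x≢r childless = cong₂ (λ a d → a ∧ isOne d) x∈V deg≡1
    where
    deg≡1 : deg edges x ≡ 1
    deg≡1 = card-singleton (adj edges x) (parent x) (adj-edges⁺ (Child⁺ x∈V x≢r)) only-parent
      where
      only-parent : ∀ w → adj edges x w ≡ true → w ≡ parent x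
      only-parent w p with adj-edges⁻ p
      ... | inj₁ x→w = sym (proj₂ (proj₂ (Child⁻ x→w)))
      ... | inj₂ w→x with Child⁻ w→x
      ...   | w∈V , w≢r , pw≡x = ⊥-elim (childless w w∈V w≢r pw≡x)

module Attach {g : List Bool} {r : Fin n} (P : ParentTree g r) (L : Fin n → Bool) (anchor : Fin n → Fin n) (ρ : ℕ)
              (rank<ρ : ∀ v → ParentTree.V P v ≡ true → ParentTree.rank P v <ₙ ρ)
              (anchor-ok : ∀ u → L u ≡ true →
                           ParentTree.V P (anchor u) ≡ true × adj g u (anchor u) ≡ true) where
  open ParentTree P

  V′ : Fin n → Bool
  V′ x = V x ∨ L x

  parent′ : Fin n → Fin n
  parent′ x = if V x then parent x else anchor x

  rank′ : Fin n → ℕ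
  rank′ x = if V x then rank x else ρ

  rank′-old : ∀ {x} → V x ≡ true → rank′ x ≡ rank x
  rank′-old x∈V rewrite x∈V = refl

  ⊆V′ : ∀ {x} → V x ≡ true → V′ x ≡ true
  ⊆V′ x∈V rewrite x∈V = refl

  parent′-ok : ∀ v → V′ v ≡ true → v ≢ r →
               V′ (parent′ v) ≡ true × rank′ (parent′ v) <ₙ rank′ v × adj g v (parent′ v) ≡ true
  parent′-ok v v∈V′ v≢r with V v in v∈V
  ... | true with parent-ok v v∈V v≢r
  ...   | pv∈V , rpv<rv , edge = ⊆V′ pv∈V , subst (_<ₙ rank v) (sym (rank′-old pv∈V)) rpv<rv , edge
  parent′-ok v v∈L v≢r | false with anchor-ok v v∈L
  ...   | av∈V , edge = ⊆V′ av∈V , subst (_<ₙ ρ) (sym (rank′-old av∈V)) (rank<ρ (anchor v) av∈V) , edge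

  tree : ParentTree g r
  tree = record { V = V′ ; parent = parent′ ; rank = rank′ ; root∈V = ⊆V′ root∈V ; parent-ok = parent′-ok }

  parent′-∈V : ∀ y → V′ y ≡ true → y ≢ r → V (parent′ y) ≡ true
  parent′-∈V y y∈V′ y≢r with V y in y∈V
  ... | true  = proj₁ (parent-ok y y∈V y≢r)
  ... | false = proj₁ (anchor-ok y y∈V′)

  new-leaf : ∀ x → V x ≡ false → L x ≡ true → isLeafT V′ (ParentTreeProperties.edges tree) x ≡ true
  new-leaf x x∉V x∈L = ParentTreeProperties.leaf tree x (subst (λ b → b ∨ L x ≡ true) (sym x∉V) x∈L)
    (λ { refl → true≢false root∈V x∉V })
    (λ y y∈V′ y≢r pyx → true≢false (parent′-∈V y y∈V′ y≢r) (subst (λ z → V z ≡ false) (sym pyx) x∉V))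

-- Growing trees in graphs where large sets are joined by an edge

module Growth {n : ℕ} (g : List Bool) where

  Closed : (Fin n → Bool) → Set
  Closed X = ∀ u w → X w ≡ true → X u ≡ false → adj g w u ≡ false

  LargeSetsJoined : ℕ → Set
  LargeSetsJoined k = ∀ (A B : Fin n → Bool) → (∀ x → A x ∧ B x ≡ false) → k ≤ₙ card A → k ≤ₙ card B →
                      Σ (Fin n) λ x → Σ (Fin n) λ y → A x ≡ true × B y ≡ true × adj g x y ≡ true

  closed-∨ : {X Y : Fin n → Bool} → Closed X → Closed Y → Closed (λ x → X x ∨ Y x)
  closed-∨ {X} {Y} closedX closedY u w w∈X∪Y u∉X∪Y with Boolₚ.∨-conicalˡ (X u) (Y u) u∉X∪Y
                                                      | Boolₚ.∨-conicalʳ (X u) (Y u) u∉X∪Y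
                                                      | ∨-true⁻ (X w) w∈X∪Y
  ... | u∉X | _   | inj₁ w∈X = closedX u w w∈X u∉X
  ... | _   | u∉Y | inj₂ w∈Y = closedY u w w∈Y u∉Y

  closed-small-or-cosmall : ∀ {k} → LargeSetsJoined k → {X : Fin n → Bool} → Closed X →
                            card X <ₙ k ⊎ card (not ∘ X) <ₙ k
  closed-small-or-cosmall {k} joined {X} closedX with card X ℕ.<? k | card (not ∘ X) ℕ.<? k
  ... | yes small | _         = inj₁ small
  ... | no _      | yes small = inj₂ small
  ... | no large  | no colarge
    with joined X (not ∘ X) (λ x → Boolₚ.∧-inverseʳ (X x)) (ℕₚ.≮⇒≥ large) (ℕₚ.≮⇒≥ colarge)
  ...   | x , y , x∈X , y∉X , xy = ⊥-elim (true≢false xy (closedX y x x∈X (not-true⁻ y∉X)))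

  record SizedTree (r : Fin n) (s : ℕ) : Set where
    field
      tree      : ParentTree g r
      rank<size : ∀ v → ParentTree.V tree v ≡ true → ParentTree.rank tree v <ₙ s
      card≡size : card (ParentTree.V tree) ≡ s

    V : Fin n → Bool
    V = ParentTree.V tree

  singletonTree : ∀ v → SizedTree v 1
  singletonTree v = record
    { tree      = record { V = λ x → eqF x v ; parent = λ x → x ; rank = λ _ → 0 ; root∈V = eqF-refl v
                         ; parent-ok = λ x x≡v x≢v → ⊥-elim (x≢v (eqF-true⁻ x≡v)) }
    ; rank<size = λ _ _ → s≤s z≤n
    ; card≡size = card-point v
    }

  extend : ∀ {r s} (T : SizedTree r s) (u w : Fin n) → SizedTree.V T u ≡ false → SizedTree.V T w ≡ true →
           adj g u w ≡ true → SizedTree r (suc s)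
  extend {r} {s} T u w u∉V w∈V uw = record
    { tree      = A.tree
    ; rank<size = rank<suc-s
    ; card≡size = card-V′
    }
    where
    open SizedTree T
    module A = Attach tree (λ x → eqF x u) (λ _ → w) s rank<size
                      (λ x x≡u → w∈V , subst (λ x → adj g x w ≡ true) (sym (eqF-true⁻ x≡u)) uw)

    rank<suc-s : ∀ v → A.V′ v ≡ true → A.rank′ v <ₙ suc s
    rank<suc-s v _ with V v in v∈V
    ... | true  = ℕₚ.m<n⇒m<1+n (rank<size v v∈V)
    ... | false = ℕₚ.≤-refl

    V∧u-empty : ∀ x → V x ∧ eqF x u ≡ false
    V∧u-empty x with eqF x u in x≡u
    ... | false = Boolₚ.∧-zeroʳ (V x)
    ... | true rewrite eqF-true⁻ x≡u | u∉V = refl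

    card-V′ : card A.V′ ≡ suc s
    card-V′ = begin
      card A.V′                              ≡⟨ sym (ℕₚ.+-identityʳ _) ⟩
      card A.V′ + 0                          ≡⟨ cong (λ c → card A.V′ + c) (sym (card-empty _ V∧u-empty)) ⟩
      card A.V′ + card (λ x → V x ∧ eqF x u) ≡⟨ card-∨+card-∧ V (λ x → eqF x u) ⟩
      card V + card (λ x → eqF x u)          ≡⟨ cong₂ _+_ card≡size (card-point u) ⟩
      s + 1                                  ≡⟨ ℕₚ.+-comm s 1 ⟩
      suc s                                  ∎
      where open ≡-Reasoning

  module _ {r s} (T : SizedTree r s) where
    open SizedTree T

    grow : SizedTree r (suc s) ⊎ Closed V
    grow with Finₚ.any? (λ u → Finₚ.any? (λ w → (not (V u) ∧ V w ∧ adj g w u) Boolₚ.≟ true))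
    ... | yes (u , w , u∉V∧w∈V∧wu) with ∧-true⁻ {not (V u)} u∉V∧w∈V∧wu
    ...   | u∉V , w∈V∧wu with ∧-true⁻ {V w} w∈V∧wu
    ...     | w∈V , wu = inj₁ (extend T u w (not-true⁻ u∉V) w∈V (trans (adj-sym g u w) wu))
    grow | no no-boundary-edge = inj₂ closed
      where
      closed : Closed V
      closed u w w∈V u∉V with adj g w u in wu
      ... | false = refl
      ... | true  = ⊥-elim (no-boundary-edge (u , w , subst₂ (λ a b → not a ∧ b ∧ adj g w u ≡ true)
                                                             (sym u∉V) (sym w∈V) wu))

  SmallClosedAround : Fin n → ℕ → Set
  SmallClosedAround v s = Σ (Fin n → Bool) λ X → Closed X × X v ≡ true × card X <ₙ s

  growBy : (m : ℕ) → ∀ {r s} → SizedTree r s → SizedTree r (m + s) ⊎ SmallClosedAround r (m + s)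
  growBy zero    T = inj₁ T
  growBy (suc m) {r} {s} T with grow T
  ... | inj₂ closed = inj₂ (SizedTree.V T , closed , ParentTree.root∈V (SizedTree.tree T) ,
                            subst (_<ₙ suc m + s) (sym (SizedTree.card≡size T)) (ℕₚ.m<n+m s (s≤s z≤n)))
  ... | inj₁ T′ with growBy m T′
  ...   | inj₁ T″                  = inj₁ (subst (SizedTree r) (ℕₚ.+-suc m s) T″)
  ...   | inj₂ (X , closed , r∈X , small) = inj₂ (X , closed , r∈X , subst (card X <ₙ_) (ℕₚ.+-suc m s) small)

  treeOrCover : ∀ k (vs : List (Fin n)) →
                (Σ (Fin n) λ r → SizedTree r (suc k)) ⊎ (∀ v → v ∈ vs → SmallClosedAround v (suc k))
  treeOrCover k []       = inj₂ (λ v ())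
  treeOrCover k (v ∷ vs) with growBy k (singletonTree v) | treeOrCover k vs
  ... | inj₁ T     | _           = inj₁ (v , subst (SizedTree v) (ℕₚ.+-comm k 1) T)
  ... | inj₂ _     | inj₁ found  = inj₁ found
  ... | inj₂ small | inj₂ cover  = inj₂ λ where
                                     w (here refl) → subst (SmallClosedAround v) (ℕₚ.+-comm k 1) small
                                     w (there w∈vs) → cover w w∈vs

  -- A union of closed sets of size < k is closed, so it stays small as long as it cannot jump past n - k.
  no-small-closed-cover : ∀ {k} → 1 ≤ₙ k → k + k + k ≤ₙ n → LargeSetsJoined k → ¬ (∀ v → SmallClosedAround v k)
  no-small-closed-cover {k} 1≤k 3k≤n joined cover =
    ℕₚ.<-irrefl ⋃-all (ℕₚ.<-≤-trans (⋃-small (allFin n)) (ℕₚ.≤-trans (ℕₚ.m≤m+n k (k + k))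
                                                             (subst (_≤ₙ n) (ℕₚ.+-assoc k k k) 3k≤n)))
    where
    C : Fin n → Fin n → Bool
    C v = proj₁ (cover v)

    ⋃ : List (Fin n) → Fin n → Bool
    ⋃ vs x = anyᵇ (λ v → C v x) vs

    ⋃-closed : ∀ vs → Closed (⋃ vs)
    ⋃-closed []       u w ()
    ⋃-closed (v ∷ vs) = closed-∨ (proj₁ (proj₂ (cover v))) (⋃-closed vs)

    ⋃-small : ∀ vs → card (⋃ vs) <ₙ k
    ⋃-small []       = subst (_<ₙ k) (sym (card-empty (⋃ []) (λ _ → refl))) 1≤k
    ⋃-small (v ∷ vs) with closed-small-or-cosmall joined (⋃-closed (v ∷ vs))
    ... | inj₁ small   = small
    ... | inj₂ cosmall = ⊥-elim (ℕₚ.<-irrefl refl (begin-strict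
      n                                                   ≡⟨ sym (card-complement (⋃ (v ∷ vs))) ⟩
      card (⋃ (v ∷ vs)) + card (not ∘ ⋃ (v ∷ vs))         ≤⟨ ℕₚ.+-monoˡ-≤ _ (card-∨ (C v) (⋃ vs)) ⟩
      card (C v) + card (⋃ vs) + card (not ∘ ⋃ (v ∷ vs))
        <⟨ ℕₚ.+-mono-< (ℕₚ.+-mono-< Cv-small (⋃-small vs)) cosmall ⟩
      k + k + k                                           ≤⟨ 3k≤n ⟩
      n                                                   ∎))
      where
      open ℕₚ.≤-Reasoning
      Cv-small = proj₂ (proj₂ (proj₂ (cover v)))

    ⋃-all : card (⋃ (allFin n)) ≡ n
    ⋃-all = card-full _ (λ x → anyᵇ-true⁺ (λ v → C v x) (∈-allFin x) (proj₁ (proj₂ (proj₂ (cover x)))))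

  -- Every vertex seeing the tree is hung below it as a leaf; the vertices that do not see the
  -- tree form a set with no edge to the k tree vertices, so there are fewer than k of them.
  module StarExtension {r k} (T : SizedTree r k) (joined : LargeSetsJoined k) where
    open SizedTree T

    neighbour? : (x : Fin n) → Dec (∃ λ w → (V w ∧ adj g x w) ≡ true)
    neighbour? x = Finₚ.any? (λ w → (V w ∧ adj g x w) Boolₚ.≟ true)

    seesTree : Fin n → Bool
    seesTree x = does (neighbour? x)

    anchor : Fin n → Fin n
    anchor x with neighbour? x
    ... | yes (w , _) = w
    ... | no _        = r

    anchor-ok : ∀ x → seesTree x ≡ true → V (anchor x) ≡ true × adj g x (anchor x) ≡ true
    anchor-ok x sees with neighbour? x
    ... | yes (w , w∈V∧xw) = ∧-true⁻ w∈V∧xw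

    seesTree⁺ : ∀ {x w} → V w ≡ true → adj g x w ≡ true → seesTree x ≡ true
    seesTree⁺ {x} {w} w∈V xw with neighbour? x
    ... | yes _   = refl
    ... | no none = ⊥-elim (none (w , cong₂ _∧_ w∈V xw))

    module A = Attach tree seesTree anchor k rank<size anchor-ok

    Leaves Unseen : Fin n → Bool
    Leaves x = not (V x) ∧ seesTree x
    Unseen x = not (V x ∨ seesTree x)

    edges : List Bool
    edges = ParentTreeProperties.edges A.tree

    leaves≤leafCount : card Leaves ≤ₙ leafCount A.V′ edges
    leaves≤leafCount = card-mono leaf
      where
      leaf : ∀ x → Leaves x ≡ true → isLeafT A.V′ edges x ∨ isLeafI A.V′ edges x ≡ true
      leaf x x∈L with ∧-true⁻ {not (V x)} x∈L
      ... | x∉V , sees rewrite A.new-leaf x (not-true⁻ x∉V) sees = refl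

    unseen-small : card Unseen <ₙ k
    unseen-small with k ℕ.≤? card Unseen
    ... | no  small = ℕₚ.≰⇒> small
    ... | yes large with joined V Unseen disjoint (ℕₚ.≤-reflexive (sym card≡size)) large
      where
      disjoint : ∀ x → V x ∧ Unseen x ≡ false
      disjoint x with V x
      ... | true  = refl
      ... | false = refl
    ...   | x , y , x∈V , y-unseen , xy =
      ⊥-elim (true≢false y-unseen (cong not (trans (cong (V y ∨_) (seesTree⁺ x∈V (trans (adj-sym g y x) xy)))
                                                   (Boolₚ.∨-zeroʳ (V y)))))

    partition : k + card Leaves + card Unseen ≡ n
    partition = trans (cong (λ c → c + card Leaves + card Unseen) (sym card≡size))
                      (card-partition₃ V Leaves Unseen (λ x → one-of-three (V x) (seesTree x)))
      where
      one-of-three : ∀ a b → 𝟙 a + 𝟙 (not a ∧ b) + 𝟙 (not (a ∨ b)) ≡ 1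
      one-of-three true  _     = refl
      one-of-three false true  = refl
      one-of-three false false = refl

    many-leaves : n + 1 ≤ₙ leafCount A.V′ edges + (k + k)
    many-leaves = begin
      n + 1                               ≡⟨ cong (_+ 1) (sym partition) ⟩
      k + card Leaves + card Unseen + 1   ≡⟨ rearrange k (card Leaves) (card Unseen) ⟩
      card Leaves + (k + suc (card Unseen)) ≤⟨ ℕₚ.+-monoʳ-≤ (card Leaves) (ℕₚ.+-monoʳ-≤ k unseen-small) ⟩
      card Leaves + (k + k)               ≤⟨ ℕₚ.+-monoˡ-≤ (k + k) leaves≤leafCount ⟩
      leafCount A.V′ edges + (k + k)      ∎
      where
      open ℕₚ.≤-Reasoning
      rearrange : ∀ k l u → k + l + u + 1 ≡ l + (k + suc u)
      rearrange = solve 3 (λ k l u → k :+ l :+ u :+ con 1 := l :+ (k :+ (con 1 :+ u))) refl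
        where open ℕSolver.+-*-Solver

  many-leaf-tree : ∀ {k} → 1 ≤ₙ k → k + k + k ≤ₙ n → LargeSetsJoined k →
                   Σ (Fin n → Bool) λ V → Σ (List Bool) λ t → IsSubtree g V t × n + 1 ≤ₙ leafCount V t + (k + k)
  many-leaf-tree {suc k} _ 3k≤n joined with treeOrCover k (allFin n)
  ... | inj₁ (r , T) = A.V′ , edges , ParentTreeProperties.isSubtree A.tree , many-leaves
    where open StarExtension T joined
  ... | inj₂ cover   = ⊥-elim (no-small-closed-cover (s≤s z≤n) 3k≤n joined (λ v → cover v (∈-allFin v)))

*-monoˡ-≤ : ∀ {r a b} → 0ℚ ≤ r → a ≤ b → r * a ≤ r * b
*-monoˡ-≤ {r} 0≤r = ℚₚ.*-monoˡ-≤-nonNeg r {{nonNegative 0≤r}}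

*-monoʳ-≤ : ∀ {r a b} → 0ℚ ≤ r → a ≤ b → a * r ≤ b * r
*-monoʳ-≤ {r} 0≤r = ℚₚ.*-monoʳ-≤-nonNeg r {{nonNegative 0≤r}}

0≤1 : 0ℚ ≤ 1ℚ
0≤1 = ℚₚ.<⇒≤ (ℚₚ.positive⁻¹ 1ℚ)

*-nonNeg : ∀ {a b} → 0ℚ ≤ a → 0ℚ ≤ b → 0ℚ ≤ a * b
*-nonNeg {a} 0≤a 0≤b = subst (_≤ a * _) (ℚₚ.*-zeroʳ a) (*-monoˡ-≤ 0≤a 0≤b)

+-nonNeg : ∀ {a b} → 0ℚ ≤ a → 0ℚ ≤ b → 0ℚ ≤ a +ℚ b
+-nonNeg 0≤a 0≤b = ℚₚ.+-mono-≤ 0≤a 0≤b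

≤-+-nonNeg : ∀ {a b c} → 0ℚ ≤ a → b ≤ c → b ≤ a +ℚ c
≤-+-nonNeg {a} {b} 0≤a b≤c = subst (_≤ a +ℚ _) (ℚₚ.+-identityˡ b) (ℚₚ.+-mono-≤ 0≤a b≤c)

p-q≤p : ∀ {a b} → 0ℚ ≤ b → a - b ≤ a
p-q≤p {a} 0≤b = subst (a - _ ≤_) (ℚₚ.+-identityʳ a) (ℚₚ.+-monoʳ-≤ a (ℚₚ.neg-antimono-≤ 0≤b))

0≤1-p : ∀ {p} → p ≤ 1ℚ → 0ℚ ≤ 1ℚ - p
0≤1-p {p} p≤1 = subst (_≤ 1ℚ - p) (ℚₚ.+-inverseʳ p) (ℚₚ.+-monoˡ-≤ (Data.Rational.-_ p) p≤1)

-‿antimonoʳ-≤ : ∀ a {b c} → b ≤ c → a - c ≤ a - b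
-‿antimonoʳ-≤ a b≤c = ℚₚ.+-monoʳ-≤ a (ℚₚ.neg-antimono-≤ b≤c)

^-nonNeg : ∀ {x} → 0ℚ ≤ x → ∀ m → 0ℚ ≤ x ^ m
^-nonNeg 0≤x zero    = 0≤1
^-nonNeg 0≤x (suc m) = *-nonNeg 0≤x (^-nonNeg 0≤x m)

^-≤1 : ∀ {x} → 0ℚ ≤ x → x ≤ 1ℚ → ∀ m → x ^ m ≤ 1ℚ
^-≤1 0≤x x≤1 zero        = ℚₚ.≤-refl
^-≤1 {x} 0≤x x≤1 (suc m) = ℚₚ.≤-trans (*-monoˡ-≤ 0≤x (^-≤1 0≤x x≤1 m))
                                      (subst (_≤ 1ℚ) (sym (ℚₚ.*-identityʳ x)) x≤1)

^-antitone : ∀ {x} → 0ℚ ≤ x → x ≤ 1ℚ → ∀ {a b} → a ≤ₙ b → x ^ b ≤ x ^ a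
^-antitone 0≤x x≤1 {b = b} z≤n   = ^-≤1 0≤x x≤1 b
^-antitone 0≤x x≤1 (s≤s a≤b) = *-monoˡ-≤ 0≤x (^-antitone 0≤x x≤1 a≤b)

-- Unlike the + a / 1 of the statement, ι is already normalised, so sums and products of ι's compute.
ι : ℕ → ℚ
ι a = mkℚ (+ a) 0 (Coprimality.sym (Coprimality.1-coprimeTo a))

/1≡ι : ∀ a → + a / 1 ≡ ι a
/1≡ι a = ℚₚ.normalize-coprime (Coprimality.sym (Coprimality.1-coprimeTo a))

ι-+ : ∀ a b → ι (a + b) ≡ ι a +ℚ ι b
ι-+ a b = sym (begin
  ι a +ℚ ι b               ≡⟨ cong₂ (λ x y → (x ℤ.+ y) / 1) (ℤₚ.+◃n≡+n (a *ₙ 1)) (ℤₚ.+◃n≡+n (b *ₙ 1)) ⟩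
  + (a *ₙ 1 + b *ₙ 1) / 1  ≡⟨ cong (λ c → + c / 1) (cong₂ _+_ (ℕₚ.*-identityʳ a) (ℕₚ.*-identityʳ b)) ⟩
  + (a + b) / 1            ≡⟨ /1≡ι (a + b) ⟩
  ι (a + b)                ∎)
  where open ≡-Reasoning

ι-* : ∀ a b → ι (a *ₙ b) ≡ ι a * ι b
ι-* a b = sym (trans (cong (_/ 1) (ℤₚ.+◃n≡+n (a *ₙ b))) (/1≡ι (a *ₙ b)))

ι-^ : ∀ a m → ι (a ℕ.^ m) ≡ ι a ^ m
ι-^ a zero    = refl
ι-^ a (suc m) = trans (ι-* a (a ℕ.^ m)) (cong (ι a *_) (ι-^ a m))

ι-mono-≤ : ∀ {a b} → a ≤ₙ b → ι a ≤ ι b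
ι-mono-≤ {a} {b} a≤b = *≤* (subst₂ ℤ._≤_ (sym (ℤₚ.+◃n≡+n (a *ₙ 1))) (sym (ℤₚ.+◃n≡+n (b *ₙ 1)))
                                (ℤ.+≤+ (ℕₚ.*-monoˡ-≤ 1 a≤b)))

ι-nonNeg : ∀ a → 0ℚ ≤ ι a
ι-nonNeg a = ι-mono-≤ z≤n

ι-pos : ∀ a → 0ℚ < ι (suc a)
ι-pos a = *<* (ℤ.+<+ (s≤s z≤n))

inv*ι : ∀ n .{{_ : ℕ.NonZero n}} → inv n * ι n ≡ 1ℚ
inv*ι (suc m) = trans (cong (_* ι (suc m)) (ℚₚ.normalize-coprime (Coprimality.1-coprimeTo (suc m))))
                      (ℚₚ.*-inverseˡ (ι (suc m)))

inv-nonNeg : ∀ m → 0ℚ ≤ inv m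
inv-nonNeg zero    = ℚₚ.≤-refl
inv-nonNeg (suc m) = subst (0ℚ ≤_) (sym (ℚₚ.normalize-coprime (Coprimality.1-coprimeTo (suc m)))) (*≤* (ℤ.+≤+ z≤n))

*ι-cancel-≤ : ∀ {a b} m → a * ι (suc m) ≤ b * ι (suc m) → a ≤ b
*ι-cancel-≤ m = ℚₚ.*-cancelʳ-≤-pos (ι (suc m)) {{positive (ι-pos m)}}

bernoulli : ∀ {p} → 0ℚ ≤ p → p ≤ 1ℚ → ∀ m → (1ℚ - p) ^ m * (1ℚ +ℚ ι m * p) ≤ 1ℚ
bernoulli {p} 0≤p p≤1 zero    = ℚₚ.≤-reflexive (solve 1 (λ p → con 1ℚ :* (con 1ℚ :+ con 0ℚ :* p) := con 1ℚ) refl p)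
  where open +-*-Solver
bernoulli {p} 0≤p p≤1 (suc m) = begin
  (1ℚ - p) ^ suc m * (1ℚ +ℚ ι (suc m) * p)
    ≡⟨ cong (λ c → (1ℚ - p) ^ suc m * (1ℚ +ℚ c * p)) (ι-+ 1 m) ⟩
  (1ℚ - p) ^ suc m * (1ℚ +ℚ (1ℚ +ℚ ι m) * p)
    ≡⟨ expand p (ι m) ((1ℚ - p) ^ m) ⟩
  (1ℚ - p) ^ m * ((1ℚ +ℚ ι m * p) - (1ℚ +ℚ ι m) * (p * p))
    ≤⟨ *-monoˡ-≤ (^-nonNeg (0≤1-p p≤1) m) (p-q≤p (*-nonNeg (+-nonNeg 0≤1 (ι-nonNeg m)) (*-nonNeg 0≤p 0≤p))) ⟩
  (1ℚ - p) ^ m * (1ℚ +ℚ ι m * p)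
    ≤⟨ bernoulli 0≤p p≤1 m ⟩
  1ℚ ∎
  where
  open ℚₚ.≤-Reasoning
  expand : ∀ p x y → (1ℚ - p) * y * (1ℚ +ℚ (1ℚ +ℚ x) * p) ≡ y * ((1ℚ +ℚ x * p) - (1ℚ +ℚ x) * (p * p))
  expand = solve 3 (λ p x y → (con 1ℚ :- p) :* y :* (con 1ℚ :+ (con 1ℚ :+ x) :* p)
                              := y :* ((con 1ℚ :+ x :* p) :- (con 1ℚ :+ x) :* (p :* p))) refl
    where open +-*-Solver

filterᵇ-map : {A B : Set} (f : B → Bool) (h : A → B) (xs : List A) →
              filterᵇ f (map h xs) ≡ map h (filterᵇ (f ∘ h) xs)
filterᵇ-map f h []       = refl
filterᵇ-map f h (x ∷ xs) with f (h x)
... | true  = cong (h x ∷_) (filterᵇ-map f h xs)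
... | false = filterᵇ-map f h xs

filterᵇ-false : {A : Set} (xs : List A) → filterᵇ (λ _ → false) xs ≡ []
filterᵇ-false []       = refl
filterᵇ-false (x ∷ xs) = filterᵇ-false xs

bitLists : ℕ → List (List Bool)
bitLists zero    = [] ∷ []
bitLists (suc N) = map (true ∷_) (bitLists N) ++ map (false ∷_) (bitLists N)

bitLists-unique : ∀ N → Unique (bitLists N)
bitLists-unique zero    = [] ∷ []
bitLists-unique (suc N) = Uniqueₚ.++⁺ (Uniqueₚ.map⁺ ∷-injectiveʳ (bitLists-unique N))
                                      (Uniqueₚ.map⁺ ∷-injectiveʳ (bitLists-unique N)) disjoint
  where
  open import Data.List.Properties using (∷-injectiveʳ)
  disjoint : ∀ {v} → v ∈ map (true ∷_) (bitLists N) × v ∈ map (false ∷_) (bitLists N) → ⊥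
  disjoint (v∈t , v∈f) with ∈-map⁻ (true ∷_) v∈t | ∈-map⁻ (false ∷_) v∈f
  ... | _ , _ , refl | _ , _ , ()

bitLists-length : ∀ N → All (λ g → length g ≡ N) (bitLists N)
bitLists-length zero    = refl ∷ []
bitLists-length (suc N) = Allₚ.++⁺ (Allₚ.map⁺ (All.map (cong suc) (bitLists-length N)))
                                   (Allₚ.map⁺ (All.map (cong suc) (bitLists-length N)))

avoids : List Bool → List Bool → Bool
avoids (a ∷ m) (b ∷ g) = not (a ∧ b) ∧ avoids m g
avoids _       _       = true

module Measure (p : ℚ) (0≤p : 0ℚ ≤ p) (p≤1 : p ≤ 1ℚ) where

  μ : List (List Bool) → ℚ
  μ = totalWeight p

  bitWeight : Bool → ℚ
  bitWeight b = if b then p else 1ℚ - p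

  weight-nonNeg : ∀ g → 0ℚ ≤ weight p g
  weight-nonNeg []          = 0≤1
  weight-nonNeg (true ∷ g)  = *-nonNeg 0≤p (weight-nonNeg g)
  weight-nonNeg (false ∷ g) = *-nonNeg (0≤1-p p≤1) (weight-nonNeg g)

  μ-++ : ∀ xs ys → μ (xs ++ ys) ≡ μ xs +ℚ μ ys
  μ-++ []       ys = sym (ℚₚ.+-identityˡ (μ ys))
  μ-++ (x ∷ xs) ys = trans (cong (weight p x +ℚ_) (μ-++ xs ys)) (sym (ℚₚ.+-assoc (weight p x) (μ xs) (μ ys)))

  μ-map-∷ : ∀ b xs → μ (map (b ∷_) xs) ≡ bitWeight b * μ xs
  μ-map-∷ b []       = sym (ℚₚ.*-zeroʳ (bitWeight b))
  μ-map-∷ b (x ∷ xs) = trans (cong (bitWeight b * weight p x +ℚ_) (μ-map-∷ b xs))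
                             (sym (ℚₚ.*-distribˡ-+ (bitWeight b) (weight p x) (μ xs)))

  μ-filter-bitLists-∷ : ∀ (f : List Bool → Bool) N →
    μ (filterᵇ f (bitLists (suc N))) ≡
    p * μ (filterᵇ (f ∘ (true ∷_)) (bitLists N)) +ℚ (1ℚ - p) * μ (filterᵇ (f ∘ (false ∷_)) (bitLists N))
  μ-filter-bitLists-∷ f N = begin
    μ (filterᵇ f (map (true ∷_) B ++ map (false ∷_) B))
      ≡⟨ cong μ (LP.filter-++ (T? ∘ f) (map (true ∷_) B) _) ⟩
    μ (filterᵇ f (map (true ∷_) B) ++ filterᵇ f (map (false ∷_) B))
      ≡⟨ μ-++ (filterᵇ f (map (true ∷_) B)) _ ⟩
    μ (filterᵇ f (map (true ∷_) B)) +ℚ μ (filterᵇ f (map (false ∷_) B))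
      ≡⟨ cong₂ _+ℚ_ (half true) (half false) ⟩
    p * μ (filterᵇ (f ∘ (true ∷_)) B) +ℚ (1ℚ - p) * μ (filterᵇ (f ∘ (false ∷_)) B) ∎
    where
    open ≡-Reasoning
    B : List (List Bool)
    B = bitLists N
    half : ∀ b → μ (filterᵇ f (map (b ∷_) B)) ≡ bitWeight b * μ (filterᵇ (f ∘ (b ∷_)) B)
    half b = trans (cong μ (filterᵇ-map f (b ∷_) B)) (μ-map-∷ b (filterᵇ (f ∘ (b ∷_)) B))

  μ-bitLists : ∀ N → μ (bitLists N) ≡ 1ℚ
  μ-bitLists zero    = ℚₚ.+-identityʳ 1ℚ
  μ-bitLists (suc N) = begin
    μ (bitLists (suc N))
      ≡⟨ μ-++ (map (true ∷_) (bitLists N)) _ ⟩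
    μ (map (true ∷_) (bitLists N)) +ℚ μ (map (false ∷_) (bitLists N))
      ≡⟨ cong₂ _+ℚ_ (μ-map-∷ true (bitLists N)) (μ-map-∷ false (bitLists N)) ⟩
    p * μ (bitLists N) +ℚ (1ℚ - p) * μ (bitLists N)
      ≡⟨ cong (λ c → p * c +ℚ (1ℚ - p) * c) (μ-bitLists N) ⟩
    p * 1ℚ +ℚ (1ℚ - p) * 1ℚ
      ≡⟨ solve 1 (λ p → p :* con 1ℚ :+ (con 1ℚ :- p) :* con 1ℚ := con 1ℚ) refl p ⟩
    1ℚ ∎
    where
    open ≡-Reasoning
    open +-*-Solver

  μ-filter-complement : ∀ f xs → μ (filterᵇ f xs) +ℚ μ (filterᵇ (not ∘ f) xs) ≡ μ xs
  μ-filter-complement f []       = ℚₚ.+-identityˡ 0ℚ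
  μ-filter-complement f (x ∷ xs) with f x
  ... | true  = trans (ℚₚ.+-assoc (weight p x) _ _) (cong (weight p x +ℚ_) (μ-filter-complement f xs))
  ... | false = trans (solve 3 (λ a b c → a :+ (b :+ c) := b :+ (a :+ c)) refl
                             (μ (filterᵇ f xs)) (weight p x) (μ (filterᵇ (not ∘ f) xs)))
                      (cong (weight p x +ℚ_) (μ-filter-complement f xs))
    where open +-*-Solver

  μ-filter-mono : ∀ {f h} → (∀ g → f g ≡ true → h g ≡ true) → ∀ xs → μ (filterᵇ f xs) ≤ μ (filterᵇ h xs)
  μ-filter-mono f⇒h []       = ℚₚ.≤-refl
  μ-filter-mono {f} {h} f⇒h (x ∷ xs) with f x in fx | h x in hx
  ... | true  | true  = ℚₚ.+-monoʳ-≤ (weight p x) (μ-filter-mono f⇒h xs)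
  ... | true  | false = ⊥-elim (true≢false (f⇒h x fx) hx)
  ... | false | true  = ≤-+-nonNeg (weight-nonNeg x) (μ-filter-mono f⇒h xs)
  ... | false | false = μ-filter-mono f⇒h xs

  μ-filter-∨ : ∀ f h xs → μ (filterᵇ (λ g → f g ∨ h g) xs) ≤ μ (filterᵇ f xs) +ℚ μ (filterᵇ h xs)
  μ-filter-∨ f h []       = ℚₚ.≤-reflexive (sym (ℚₚ.+-identityˡ 0ℚ))
  μ-filter-∨ f h (x ∷ xs) with f x | h x | μ-filter-∨ f h xs
  ... | true  | true  | ih = ℚₚ.≤-trans (ℚₚ.+-monoʳ-≤ (weight p x) ih)
                              (ℚₚ.≤-trans (≤-+-nonNeg (weight-nonNeg x) ℚₚ.≤-refl)
                                          (ℚₚ.≤-reflexive (solve 3 (λ a b c → a :+ (a :+ (b :+ c)) := (a :+ b) :+ (a :+ c))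
                                                                   refl (weight p x) (μ (filterᵇ f xs)) (μ (filterᵇ h xs)))))
    where open +-*-Solver
  ... | true  | false | ih = ℚₚ.≤-trans (ℚₚ.+-monoʳ-≤ (weight p x) ih)
                              (ℚₚ.≤-reflexive (sym (ℚₚ.+-assoc (weight p x) (μ (filterᵇ f xs)) (μ (filterᵇ h xs)))))
  ... | false | true  | ih = ℚₚ.≤-trans (ℚₚ.+-monoʳ-≤ (weight p x) ih)
                              (ℚₚ.≤-reflexive (solve 3 (λ a b c → a :+ (b :+ c) := b :+ (a :+ c)) refl
                                                      (weight p x) (μ (filterᵇ f xs)) (μ (filterᵇ h xs))))
    where open +-*-Solver
  ... | false | false | ih = ih

  union-bound : {E : Set} (bad : E → List Bool → Bool) (xs : List (List Bool)) (c : ℚ) →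
                (∀ e → μ (filterᵇ (bad e) xs) ≤ c) →
                ∀ es → μ (filterᵇ (λ g → anyᵇ (λ e → bad e g) es) xs) ≤ ι (length es) * c
  union-bound bad xs c bound []       = ℚₚ.≤-reflexive (trans (cong μ (filterᵇ-false xs)) (sym (ℚₚ.*-zeroˡ c)))
  union-bound bad xs c bound (e ∷ es) = begin
    μ (filterᵇ (λ g → bad e g ∨ anyᵇ (λ e → bad e g) es) xs)
      ≤⟨ μ-filter-∨ (bad e) (λ g → anyᵇ (λ e → bad e g) es) xs ⟩
    μ (filterᵇ (bad e) xs) +ℚ μ (filterᵇ (λ g → anyᵇ (λ e → bad e g) es) xs)
      ≤⟨ ℚₚ.+-mono-≤ (bound e) (union-bound bad xs c bound es) ⟩
    c +ℚ ι (length es) * c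
      ≡⟨ solve 2 (λ c l → c :+ l :* c := (con 1ℚ :+ l) :* c) refl c (ι (length es)) ⟩
    (1ℚ +ℚ ι (length es)) * c
      ≡⟨ cong (_* c) (sym (ι-+ 1 (length es))) ⟩
    ι (length (e ∷ es)) * c ∎
    where
    open ℚₚ.≤-Reasoning
    open +-*-Solver

  μ-avoiding : ∀ N m → length m ≡ N → μ (filterᵇ (avoids m) (bitLists N)) ≡ (1ℚ - p) ^ count (λ b → b) m
  μ-avoiding zero    []      _   = ℚₚ.+-identityʳ 1ℚ
  μ-avoiding (suc N) (a ∷ m) len = trans (μ-filter-bitLists-∷ (avoids (a ∷ m)) N) (split a)
    where
    open ≡-Reasoning
    open +-*-Solver
    B : List (List Bool)
    B = bitLists N
    y : ℚ
    y = (1ℚ - p) ^ count (λ b → b) m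
    ih : μ (filterᵇ (avoids m) B) ≡ y
    ih = μ-avoiding N m (ℕₚ.suc-injective len)
    split : ∀ a → p * μ (filterᵇ (avoids (a ∷ m) ∘ (true ∷_)) B)
                    +ℚ (1ℚ - p) * μ (filterᵇ (avoids (a ∷ m) ∘ (false ∷_)) B)
                  ≡ (1ℚ - p) ^ count (λ b → b) (a ∷ m)
    split true = begin
      p * μ (filterᵇ (λ _ → false) B) +ℚ (1ℚ - p) * μ (filterᵇ (avoids m) B)
        ≡⟨ cong₂ (λ l r → p * μ l +ℚ (1ℚ - p) * r) (filterᵇ-false B) ih ⟩
      p * 0ℚ +ℚ (1ℚ - p) * y
        ≡⟨ solve 2 (λ p y → p :* con 0ℚ :+ (con 1ℚ :- p) :* y := (con 1ℚ :- p) :* y) refl p y ⟩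
      (1ℚ - p) * y ∎
    split false = begin
      p * μ (filterᵇ (avoids m) B) +ℚ (1ℚ - p) * μ (filterᵇ (avoids m) B)
        ≡⟨ cong (λ r → p * r +ℚ (1ℚ - p) * r) ih ⟩
      p * y +ℚ (1ℚ - p) * y
        ≡⟨ solve 2 (λ p y → p :* y :+ (con 1ℚ :- p) :* y := y) refl p y ⟩
      y ∎

avoids-false⁻ : {A : Set} (h : A → Bool) (ps : List A) (g : List Bool) → avoids (map h ps) g ≡ false →
                ∃ λ a → h a ≡ true × (a , true) ∈ zip ps g
avoids-false⁻ h (a ∷ ps) (b ∷ g) avoid≡false with h a in ha | b
... | true  | true  = a , ha , here refl
... | true  | false = Data.Product.map₂ (Data.Product.map₂ there) (avoids-false⁻ h ps g avoid≡false)
... | false | _     = Data.Product.map₂ (Data.Product.map₂ there) (avoids-false⁻ h ps g avoid≡false)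

count-++ : {A : Set} (f : A → Bool) (xs ys : List A) → count f (xs ++ ys) ≡ count f xs + count f ys
count-++ f []       ys = refl
count-++ f (x ∷ xs) ys with f x
... | true  = cong suc (count-++ f xs ys)
... | false = count-++ f xs ys

count-map : {A B : Set} (f : B → Bool) (h : A → B) (xs : List A) → count f (map h xs) ≡ count (f ∘ h) xs
count-map f h []       = refl
count-map f h (x ∷ xs) with f (h x)
... | true  = cong suc (count-map f h xs)
... | false = count-map f h xs

count-filter : {A : Set} {P : A → Set} (P? : ∀ a → Dec (P a)) (f : A → Bool) (xs : List A) →
               count f (filter P? xs) ≡ count (λ a → does (P? a) ∧ f a) xs
count-filter P? f []       = refl
count-filter P? f (x ∷ xs) with does (P? x)
... | false = count-filter P? f xs
... | true with f x
...   | true  = cong suc (count-filter P? f xs)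
...   | false = count-filter P? f xs

count-concat-tabulate : {A : Set} (f : A → Bool) (H : Fin n → List A) →
                        count f (Data.List.concat (tabulate H)) ≡ ∑[ i < n ] count f (H i)
count-concat-tabulate {zero}  f H = refl
count-concat-tabulate {suc n} f H =
  trans (count-++ f (H fzero) _) (cong (_+_ (count f (H fzero))) (count-concat-tabulate f (H ∘ fsuc)))

-- A double sum over Fin n, so that the row of i = 0 separates off definitionally.
pairCount : (n : ℕ) → (Fin n → Fin n → Bool) → ℕ
pairCount n F = ∑[ i < n ] ∑[ j < n ] 𝟙 (does (i <? j) ∧ F i j)

count-pairs : (F : Fin n → Fin n → Bool) → count (λ (x , y) → F x y) (pairs n) ≡ pairCount n F
count-pairs {n} F = begin
  count F′ (Data.List.concat (map row (tabulate (λ i → i))))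
    ≡⟨ cong (count F′ ∘ Data.List.concat) (LP.map-tabulate (λ i → i) row) ⟩
  count F′ (Data.List.concat (tabulate row))
    ≡⟨ count-concat-tabulate F′ row ⟩
  ∑[ i < n ] count F′ (row i)
    ≡⟨ sum-cong-≗ count-row ⟩
  pairCount n F ∎
  where
  open ≡-Reasoning
  F′ : Fin n × Fin n → Bool
  F′ (x , y) = F x y
  row : Fin n → List (Fin n × Fin n)
  row i = map (i ,_) (filter (i <?_) (allFin n))
  count-row : ∀ i → count F′ (row i) ≡ ∑[ j < n ] 𝟙 (does (i <? j) ∧ F i j)
  count-row i = trans (count-map F′ (i ,_) (filter (i <?_) (allFin n)))
                      (trans (count-filter (i <?_) (F i) (allFin n)) (card≡∑ (λ j → does (i <? j) ∧ F i j)))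

cross : (A B : Fin n → Bool) → Fin n → Fin n → Bool
cross A B x y = (A x ∧ B y) ∨ (B x ∧ A y)

pairCount-cross : ∀ n (A B : Fin n → Bool) → (∀ x → A x ∧ B x ≡ false) →
                  pairCount n (cross A B) ≡ (∑[ i < n ] 𝟙 (A i)) *ₙ (∑[ i < n ] 𝟙 (B i))
pairCount-cross zero    A B disjoint = refl
pairCount-cross (suc n) A B disjoint
  with A fzero in A0 | B fzero in B0 | pairCount-cross n (A ∘ fsuc) (B ∘ fsuc) (disjoint ∘ fsuc)
... | true  | true  | _  = ⊥-elim (true≢false (cong₂ _∧_ A0 B0) (disjoint fzero))
... | true  | false | ih = cong₂ _+_ (sum-cong-≗ (λ j → cong 𝟙 (Boolₚ.∨-identityʳ (B (fsuc j))))) ih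
... | false | true  | ih = trans (cong₂ _+_ (sum-cong-≗ (λ j → cong 𝟙 (Boolₚ.∧-identityˡ (A (fsuc j))))) ih)
                                 (sym (ℕₚ.*-suc (∑[ i < n ] 𝟙 (A (fsuc i))) (∑[ i < n ] 𝟙 (B (fsuc i)))))
... | false | false | ih = trans (cong (_+ pairCount n (cross (A ∘ fsuc) (B ∘ fsuc))) (∑-zero {n})) ih

count-edgeBits-cross : (A B : Fin n → Bool) → (∀ x → A x ∧ B x ≡ false) →
                       count (λ b → b) (edgeBits (cross A B)) ≡ card A *ₙ card B
count-edgeBits-cross {n} A B disjoint = begin
  count (λ b → b) (edgeBits (cross A B))                     ≡⟨ count-map (λ b → b) _ (pairs n) ⟩
  count (λ (x , y) → cross A B x y) (pairs n)                ≡⟨ count-pairs (cross A B) ⟩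
  pairCount n (cross A B)                                    ≡⟨ pairCount-cross n A B disjoint ⟩
  (∑[ i < n ] 𝟙 (A i)) *ₙ (∑[ i < n ] 𝟙 (B i))               ≡⟨ sym (cong₂ _*ₙ_ (card≡∑ A) (card≡∑ B)) ⟩
  card A *ₙ card B                                           ∎
  where open ≡-Reasoning

-- With high probability every two disjoint sets of k vertices are joined by an edge

subsets : (m : ℕ) → List (Fin m → Bool)
subsets zero    = (λ ()) ∷ []
subsets (suc m) = map (true ∷ᶠ_) (subsets m) ++ map (false ∷ᶠ_) (subsets m)

length-subsets : ∀ m → length (subsets m) ≡ 2 ℕ.^ m
length-subsets zero    = refl
length-subsets (suc m) = begin
  length (map (true ∷ᶠ_) (subsets m) ++ map (false ∷ᶠ_) (subsets m))
    ≡⟨ LP.length-++ (map (true ∷ᶠ_) (subsets m)) ⟩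
  length (map (true ∷ᶠ_) (subsets m)) + length (map (false ∷ᶠ_) (subsets m))
    ≡⟨ cong₂ _+_ (LP.length-map (true ∷ᶠ_) (subsets m)) (LP.length-map (false ∷ᶠ_) (subsets m)) ⟩
  length (subsets m) + length (subsets m)
    ≡⟨ cong (λ l → l + l) (length-subsets m) ⟩
  2 ℕ.^ m + 2 ℕ.^ m
    ≡⟨ cong (_+_ (2 ℕ.^ m)) (sym (ℕₚ.+-identityʳ (2 ℕ.^ m))) ⟩
  2 ℕ.^ suc m ∎
  where open ≡-Reasoning

subsets-complete : ∀ {m} (A : Fin m → Bool) → ∃ λ A′ → A′ ∈ subsets m × A ≗ A′
subsets-complete {zero}  A = (λ ()) , here refl , λ ()
subsets-complete {suc m} A with subsets-complete (A ∘ fsuc) | A fzero in A0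
... | A′ , A′∈ , A≗A′ | true  =
  true ∷ᶠ A′ , ∈-++⁺ˡ (∈-map⁺ (true ∷ᶠ_) A′∈) , λ { fzero → A0 ; (fsuc i) → A≗A′ i }
... | A′ , A′∈ , A≗A′ | false =
  false ∷ᶠ A′ , ∈-++⁺ʳ (map (true ∷ᶠ_) (subsets m)) (∈-map⁺ (false ∷ᶠ_) A′∈) , λ { fzero → A0 ; (fsuc i) → A≗A′ i }

length-cartesianProduct : {A B : Set} (xs : List A) (ys : List B) →
                          length (cartesianProduct xs ys) ≡ length xs *ₙ length ys
length-cartesianProduct []       ys = refl
length-cartesianProduct (x ∷ xs) ys =
  trans (LP.length-++ (map (x ,_) ys)) (cong₂ _+_ (LP.length-map (x ,_) ys) (length-cartesianProduct xs ys))

ProbAtLeast-mono : ∀ {n p} {E E′ : List Bool → Set} {q q′} → (∀ g → E g → E′ g) → q′ ≤ q →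
                   ProbAtLeast n p E q → ProbAtLeast n p E′ q′
ProbAtLeast-mono E⇒E′ q′≤q (S , unique , events , q≤μS) =
  S , unique , All.map (Data.Product.map₂ (E⇒E′ _)) events , ℚₚ.≤-trans q′≤q q≤μS

module LargeSetsJoinedWhp (n k : ℕ) (p : ℚ) (0≤p : 0ℚ ≤ p) (p≤1 : p ≤ 1ℚ) where
  open Measure p 0≤p p≤1

  Admissible : (A B : Fin n → Bool) → Set
  Admissible A B = (∀ x → A x ∧ B x ≡ false) × k ≤ₙ card A × k ≤ₙ card B

  admissible? : ∀ A B → Dec (Admissible A B)
  admissible? A B = Finₚ.all? (λ x → (A x ∧ B x) Boolₚ.≟ false) ×-dec (k ℕ.≤? card A ×-dec k ℕ.≤? card B)

  joinedIn : List Bool → (A B : Fin n → Bool) → Bool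
  joinedIn g A B = anyᵇ (λ x → anyᵇ (λ y → A x ∧ B y ∧ adj g x y) (allFin n)) (allFin n)

  joinedIn-true⁺ : ∀ g A B x y → A x ≡ true → B y ≡ true → adj g x y ≡ true → joinedIn g A B ≡ true
  joinedIn-true⁺ g A B x y Ax By xy =
    anyᵇ-true⁺ _ (∈-allFin x) (anyᵇ-true⁺ _ (∈-allFin y) (trans (cong₂ (λ a b → a ∧ b ∧ adj g x y) Ax By) xy))

  joinedIn-true⁻ : ∀ g A B → joinedIn g A B ≡ true →
                   Σ (Fin n) λ x → Σ (Fin n) λ y → A x ≡ true × B y ≡ true × adj g x y ≡ true
  joinedIn-true⁻ g A B joined with anyᵇ-true⁻ _ (allFin n) joined
  ... | x , _ , row with anyᵇ-true⁻ _ (allFin n) row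
  ...   | y , _ , Ax∧By∧xy with ∧-true⁻ {A x} Ax∧By∧xy
  ...     | Ax , By∧xy = x , y , Ax , proj₁ (∧-true⁻ By∧xy) , proj₂ (∧-true⁻ By∧xy)

  unjoined : (Fin n → Bool) × (Fin n → Bool) → List Bool → Bool
  unjoined (A , B) g = does (admissible? A B) ∧ not (joinedIn g A B)

  unjoined-true⁻ : ∀ {A B} g → unjoined (A , B) g ≡ true → Admissible A B × not (joinedIn g A B) ≡ true
  unjoined-true⁻ {A} {B} g unjoined≡true with ∧-true⁻ {does (admissible? A B)} unjoined≡true
  ... | admissible , not-joined = does-true⁻ (admissible? A B) admissible , not-joined

  unjoined-false⁻ : ∀ {A B} g → unjoined (A , B) g ≡ false → Admissible A B → joinedIn g A B ≡ true
  unjoined-false⁻ {A} {B} g unjoined≡false admissible =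
    Boolₚ.not-injective (trans (sym (cong (_∧ not (joinedIn g A B)) (dec-true (admissible? A B) admissible)))
                               unjoined≡false)

  unjoined⇒avoids : ∀ A B g → not (joinedIn g A B) ≡ true → avoids (edgeBits (cross A B)) g ≡ true
  unjoined⇒avoids A B g not-joined with avoids (edgeBits (cross A B)) g in avoid
  ... | true  = refl
  ... | false with avoids-false⁻ (λ (x , y) → cross A B x y) (pairs n) g avoid
  ...   | (x , y) , crossing , xy∈g with ∨-true⁻ (A x ∧ B y) crossing
  ...     | inj₁ Ax∧By = ⊥-elim (true≢false not-joined (cong not (joinedIn-true⁺ g A B x y
                           (proj₁ (∧-true⁻ Ax∧By)) (proj₂ (∧-true⁻ Ax∧By)) (adj-bit g xy∈g))))
  ...     | inj₂ Bx∧Ay = ⊥-elim (true≢false not-joined (cong not (joinedIn-true⁺ g A B y x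
                           (proj₂ (∧-true⁻ Bx∧Ay)) (proj₁ (∧-true⁻ Bx∧Ay)) (trans (adj-sym g y x) (adj-bit g xy∈g)))))

  graphs : List (List Bool)
  graphs = bitLists (numPairs n)

  μ-unjoined : ∀ e → μ (filterᵇ (unjoined e) graphs) ≤ (1ℚ - p) ^ (k *ₙ k)
  μ-unjoined (A , B) with admissible? A B
  ... | no inadmissible = begin
    μ (filterᵇ (unjoined (A , B)) graphs)
      ≤⟨ μ-filter-mono (λ g u → ⊥-elim (inadmissible (proj₁ (unjoined-true⁻ g u)))) graphs ⟩
    μ (filterᵇ (λ _ → false) graphs)
      ≡⟨ cong μ (filterᵇ-false graphs) ⟩
    0ℚ
      ≤⟨ ^-nonNeg (0≤1-p p≤1) (k *ₙ k) ⟩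
    (1ℚ - p) ^ (k *ₙ k) ∎
    where open ℚₚ.≤-Reasoning
  ... | yes (disjoint , kA , kB) = begin
    μ (filterᵇ (unjoined (A , B)) graphs)
      ≤⟨ μ-filter-mono (λ g u → unjoined⇒avoids A B g (proj₂ (unjoined-true⁻ g u))) graphs ⟩
    μ (filterᵇ (avoids (edgeBits (cross A B))) graphs)
      ≡⟨ μ-avoiding (numPairs n) (edgeBits (cross A B)) (LP.length-map (λ (x , y) → cross A B x y) (pairs n)) ⟩
    (1ℚ - p) ^ count (λ b → b) (edgeBits (cross A B))
      ≡⟨ cong ((1ℚ - p) ^_) (count-edgeBits-cross A B disjoint) ⟩
    (1ℚ - p) ^ (card A *ₙ card B)
      ≤⟨ ^-antitone (0≤1-p p≤1) (p-q≤p 0≤p) (ℕₚ.*-mono-≤ kA kB) ⟩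
    (1ℚ - p) ^ (k *ₙ k) ∎
    where open ℚₚ.≤-Reasoning

  someUnjoined : List Bool → Bool
  someUnjoined g = anyᵇ (λ e → unjoined e g) (cartesianProduct (subsets n) (subsets n))

  good⇒largeSetsJoined : ∀ g → not (someUnjoined g) ≡ true → Growth.LargeSetsJoined {n} g k
  good⇒largeSetsJoined g good A B disjoint kA kB
    with subsets-complete A | subsets-complete B
  ... | A′ , A′∈ , A≗A′ | B′ , B′∈ , B≗B′
    with joinedIn-true⁻ g A′ B′ (unjoined-false⁻ g unjoined≡false admissible)
    where
    unjoined≡false : unjoined (A′ , B′) g ≡ false
    unjoined≡false with unjoined (A′ , B′) g in u
    ... | false = refl
    ... | true  = ⊥-elim (true≢false (anyᵇ-true⁺ (λ e → unjoined e g) (∈-cartesianProduct⁺ A′∈ B′∈) u)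
                                     (not-true⁻ good))
    admissible : Admissible A′ B′
    admissible = (λ x → trans (sym (cong₂ _∧_ (A≗A′ x) (B≗B′ x))) (disjoint x))
               , subst (k ≤ₙ_) (card-cong A≗A′) kA , subst (k ≤ₙ_) (card-cong B≗B′) kB
  ... | x , y , A′x , B′y , xy = x , y , trans (A≗A′ x) A′x , trans (B≗B′ y) B′y , xy

  largeSetsJoined-whp : ProbAtLeast n p (λ g → Growth.LargeSetsJoined {n} g k)
                                      (1ℚ - ι (2 ℕ.^ n *ₙ 2 ℕ.^ n) * (1ℚ - p) ^ (k *ₙ k))
  largeSetsJoined-whp =
      filterᵇ (not ∘ someUnjoined) graphs
    , Uniqueₚ.filter⁺ _ (bitLists-unique (numPairs n))
    , All.zipWith (λ (len , good) → len , good⇒largeSetsJoined _ (Equivalence.to Boolₚ.T-≡ good))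
                  (Allₚ.filter⁺ _ (bitLists-length (numPairs n)) , Allₚ.all-filter _ graphs)
    , probability
    where
    probability : 1ℚ - ι (2 ℕ.^ n *ₙ 2 ℕ.^ n) * (1ℚ - p) ^ (k *ₙ k) ≤ μ (filterᵇ (not ∘ someUnjoined) graphs)
    probability = begin
      1ℚ - ι (2 ℕ.^ n *ₙ 2 ℕ.^ n) * (1ℚ - p) ^ (k *ₙ k)
        ≡⟨ cong (λ l → 1ℚ - ι l * (1ℚ - p) ^ (k *ₙ k)) (sym (trans (length-cartesianProduct (subsets n) (subsets n))
                                                              (cong₂ _*ₙ_ (length-subsets n) (length-subsets n)))) ⟩
      1ℚ - ι (length (cartesianProduct (subsets n) (subsets n))) * (1ℚ - p) ^ (k *ₙ k)
        ≤⟨ -‿antimonoʳ-≤ 1ℚ (union-bound unjoined graphs _ μ-unjoined (cartesianProduct (subsets n) (subsets n))) ⟩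
      1ℚ - μ (filterᵇ someUnjoined graphs)
        ≡⟨ cong (_- μ (filterᵇ someUnjoined graphs))
                (sym (trans (μ-filter-complement someUnjoined graphs) (μ-bitLists (numPairs n)))) ⟩
      μ (filterᵇ someUnjoined graphs) +ℚ μ (filterᵇ (not ∘ someUnjoined) graphs) - μ (filterᵇ someUnjoined graphs)
        ≡⟨ solve 2 (λ a b → a :+ b :- a := b) refl (μ (filterᵇ someUnjoined graphs))
                                                   (μ (filterᵇ (not ∘ someUnjoined) graphs)) ⟩
      μ (filterᵇ (not ∘ someUnjoined) graphs) ∎
      where
      open ℚₚ.≤-Reasoning
      open +-*-Solver

-- The choice of parameters: k = 5e with e = ⌊n / 25⌋ + 1, so that n ≤ 25e and k² ≥ n e

n<2^n : ∀ n → n <ₙ 2 ℕ.^ n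
n<2^n zero    = s≤s z≤n
n<2^n (suc n) = begin-strict
  suc n            ≡⟨ ℕₚ.+-comm 1 n ⟩
  n + 1            <⟨ ℕₚ.+-mono-<-≤ (n<2^n n) (ℕₚ.m^n>0 2 n) ⟩
  2 ℕ.^ n + 2 ℕ.^ n ≡⟨ cong (_+_ (2 ℕ.^ n)) (sym (ℕₚ.+-identityʳ (2 ℕ.^ n))) ⟩
  2 ℕ.^ suc n      ∎
  where open ℕₚ.≤-Reasoning

n<25+[n/25]*25 : ∀ n → n <ₙ 25 + (n ℕ./ 25) *ₙ 25
n<25+[n/25]*25 n = begin-strict
  n                           ≡⟨ DivMod.m≡m%n+[m/n]*n n 25 ⟩
  n ℕ.% 25 + (n ℕ./ 25) *ₙ 25 <⟨ ℕₚ.+-monoˡ-< ((n ℕ./ 25) *ₙ 25) (DivMod.m%n<n n 25) ⟩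
  25 + (n ℕ./ 25) *ₙ 25       ∎
  where open ℕₚ.≤-Reasoning

module Scale (n j : ℕ) (j*25≤n : j *ₙ 25 ≤ₙ n) (n<25+j*25 : n <ₙ 25 + j *ₙ 25) where
  e : ℕ
  e = suc j

  k : ℕ
  k = 5 *ₙ e

  n<25e : n <ₙ 25 *ₙ e
  n<25e = subst (n <ₙ_) 25+j*25≡25e n<25+j*25
    where
    25+j*25≡25e : 25 + j *ₙ 25 ≡ 25 *ₙ e
    25+j*25≡25e = solve 1 (λ j → con 25 :+ j :* con 25 := con 25 :* (con 1 :+ j)) refl j
      where open ℕSolver.+-*-Solver

  n*e≤k*k : n *ₙ e ≤ₙ k *ₙ k
  n*e≤k*k = begin
    n *ₙ e                  ≤⟨ ℕₚ.*-monoˡ-≤ e (ℕₚ.<⇒≤ n<25e) ⟩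
    25 *ₙ e *ₙ e            ≡⟨ solve 1 (λ e → con 25 :* e :* e := (con 5 :* e) :* (con 5 :* e)) refl e ⟩
    k *ₙ k                  ∎
    where
    open ℕₚ.≤-Reasoning
    open ℕSolver.+-*-Solver

  2^n*2^n*b≤2^75^e : ∀ b → b ≤ₙ n → 2 ℕ.^ n *ₙ 2 ℕ.^ n *ₙ b ≤ₙ (2 ℕ.^ 75) ℕ.^ e
  2^n*2^n*b≤2^75^e b b≤n = begin
    2 ℕ.^ n *ₙ 2 ℕ.^ n *ₙ b
      ≤⟨ ℕₚ.*-monoʳ-≤ (2 ℕ.^ n *ₙ 2 ℕ.^ n) (ℕₚ.<⇒≤ (ℕₚ.≤-<-trans b≤n (n<2^n n))) ⟩
    2 ℕ.^ n *ₙ 2 ℕ.^ n *ₙ 2 ℕ.^ n   ≡⟨ sym (trans (ℕₚ.^-distribˡ-+-* 2 (n + n) n)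
                                                  (cong (_*ₙ 2 ℕ.^ n) (ℕₚ.^-distribˡ-+-* 2 n n))) ⟩
    2 ℕ.^ (n + n + n)               ≤⟨ ℕₚ.^-monoʳ-≤ 2 n+n+n≤75e ⟩
    2 ℕ.^ (75 *ₙ e)                 ≡⟨ sym (ℕₚ.^-*-assoc 2 75 e) ⟩
    (2 ℕ.^ 75) ℕ.^ e                ∎
    where
    open ℕₚ.≤-Reasoning
    open ℕSolver.+-*-Solver
    n+n+n≤75e : n + n + n ≤ₙ 75 *ₙ e
    n+n+n≤75e = begin
      n + n + n                     ≡⟨ solve 1 (λ n → n :+ n :+ n := con 3 :* n) refl n ⟩
      3 *ₙ n                        ≤⟨ ℕₚ.*-monoʳ-≤ 3 (ℕₚ.<⇒≤ n<25e) ⟩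
      3 *ₙ (25 *ₙ e)                ≡⟨ solve 1 (λ e → con 3 :* (con 25 :* e) := con 75 :* e) refl e ⟩
      75 *ₙ e                       ∎

  -- n ≥ 225 makes j ≥ 9, which is the slack needed for 3k ≤ n and for 18k ≤ 4n.
  module Large (225≤n : 225 ≤ₙ n) where
    9≤j : 9 ≤ₙ j
    9≤j = ℕₚ.≮⇒≥ λ j<9 → ℕₚ.<-irrefl refl (begin-strict
      225                   ≤⟨ 225≤n ⟩
      n                     <⟨ n<25e ⟩
      25 *ₙ suc j           ≤⟨ ℕₚ.*-monoʳ-≤ 25 j<9 ⟩
      225                   ∎)
      where open ℕₚ.≤-Reasoning

    90≤10j : 90 ≤ₙ 10 *ₙ j
    90≤10j = ℕₚ.*-monoʳ-≤ 10 9≤j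

    3k≤n : k + k + k ≤ₙ n
    3k≤n = begin
      k + k + k             ≡⟨ solve 1 (λ j → let k = con 5 :* (con 1 :+ j) in k :+ k :+ k := con 15 :+ con 15 :* j) refl j ⟩
      15 + 15 *ₙ j          ≤⟨ ℕₚ.+-monoˡ-≤ (15 *ₙ j) (ℕₚ.≤-trans (ℕₚ.≤ᵇ⇒≤ 15 90 tt) 90≤10j) ⟩
      10 *ₙ j + 15 *ₙ j     ≡⟨ solve 1 (λ j → con 10 :* j :+ con 15 :* j := j :* con 25) refl j ⟩
      j *ₙ 25               ≤⟨ j*25≤n ⟩
      n                     ∎
      where
      open ℕₚ.≤-Reasoning
      open ℕSolver.+-*-Solver

    five-ninths : ∀ L → n + 1 ≤ₙ L + (k + k) → 5 *ₙ n ≤ₙ 9 *ₙ L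
    five-ninths L n<L+2k = ℕₚ.+-cancelʳ-≤ (18 *ₙ k) (5 *ₙ n) (9 *ₙ L) (begin
      5 *ₙ n + 18 *ₙ k      ≤⟨ ℕₚ.+-monoʳ-≤ (5 *ₙ n) 18k≤4n ⟩
      5 *ₙ n + 4 *ₙ n       ≡⟨ solve 1 (λ n → con 5 :* n :+ con 4 :* n := con 9 :* n) refl n ⟩
      9 *ₙ n                ≤⟨ ℕₚ.m≤m+n (9 *ₙ n) 9 ⟩
      9 *ₙ n + 9            ≡⟨ solve 1 (λ n → con 9 :* n :+ con 9 := con 9 :* (n :+ con 1)) refl n ⟩
      9 *ₙ (n + 1)          ≤⟨ ℕₚ.*-monoʳ-≤ 9 n<L+2k ⟩
      9 *ₙ (L + (k + k))    ≡⟨ solve 2 (λ L k → con 9 :* (L :+ (k :+ k)) := con 9 :* L :+ con 18 :* k) refl L k ⟩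
      9 *ₙ L + 18 *ₙ k      ∎)
      where
      open ℕₚ.≤-Reasoning
      open ℕSolver.+-*-Solver
      18k≤4n : 18 *ₙ k ≤ₙ 4 *ₙ n
      18k≤4n = begin
        18 *ₙ k             ≡⟨ solve 1 (λ j → con 18 :* (con 5 :* (con 1 :+ j)) := con 90 :+ con 90 :* j) refl j ⟩
        90 + 90 *ₙ j        ≤⟨ ℕₚ.+-monoˡ-≤ (90 *ₙ j) 90≤10j ⟩
        10 *ₙ j + 90 *ₙ j   ≡⟨ solve 1 (λ j → con 10 :* j :+ con 90 :* j := con 4 :* (j :* con 25)) refl j ⟩
        4 *ₙ (j *ₙ 25)      ≤⟨ ℕₚ.*-monoʳ-≤ 4 j*25≤n ⟩
        4 *ₙ n              ∎

-- The final estimate, for p = C / n with C = 2⁷⁵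

C : ℚ
C = ι (2 ℕ.^ 75)

module EdgeProbability (n : ℕ) .{{_ : ℕ.NonZero n}} (C≤n : C ≤ ι n) where
  open Scale n (n ℕ./ 25) (DivMod.m/n*n≤m n 25) (n<25+[n/25]*25 n) public

  p : ℚ
  p = C * inv n

  0≤p : 0ℚ ≤ p
  0≤p = *-nonNeg (ι-nonNeg _) (inv-nonNeg n)

  p≤1 : p ≤ 1ℚ
  p≤1 = ℚₚ.≤-trans (*-monoʳ-≤ (inv-nonNeg n) C≤n) (ℚₚ.≤-reflexive (trans (ℚₚ.*-comm (ι n) (inv n)) (inv*ι n)))

  C*[1-p]^n≤1 : C * (1ℚ - p) ^ n ≤ 1ℚ
  C*[1-p]^n≤1 = begin
    C * (1ℚ - p) ^ n                ≤⟨ ≤-+-nonNeg (^-nonNeg (0≤1-p p≤1) n) ℚₚ.≤-refl ⟩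
    (1ℚ - p) ^ n +ℚ C * (1ℚ - p) ^ n ≡⟨ solve 2 (λ y c → y :+ c :* y := y :* (con 1ℚ :+ c)) refl ((1ℚ - p) ^ n) C ⟩
    (1ℚ - p) ^ n * (1ℚ +ℚ C)         ≡⟨ cong (λ c → (1ℚ - p) ^ n * (1ℚ +ℚ c)) (sym n*p≡C) ⟩
    (1ℚ - p) ^ n * (1ℚ +ℚ ι n * p)   ≤⟨ bernoulli 0≤p p≤1 n ⟩
    1ℚ                              ∎
    where
    open ℚₚ.≤-Reasoning
    open +-*-Solver
    n*p≡C : ι n * p ≡ C
    n*p≡C = trans (solve 3 (λ x c y → x :* (c :* y) := c :* (y :* x)) refl (ι n) C (inv n))
                  (trans (cong (C *_) (inv*ι n)) (ℚₚ.*-identityʳ C))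

  unjoined-bound : ∀ b → suc b ≤ₙ n → ι (2 ℕ.^ n *ₙ 2 ℕ.^ n) * (1ℚ - p) ^ (k *ₙ k) ≤ 1/ ι (suc b)
  unjoined-bound b b<n = *ι-cancel-≤ b (begin
    ι P * (1ℚ - p) ^ (k *ₙ k) * ι (suc b)
      ≤⟨ *-monoʳ-≤ (ι-nonNeg (suc b)) (*-monoˡ-≤ (ι-nonNeg P) (^-antitone (0≤1-p p≤1) (p-q≤p 0≤p) n*e≤k*k)) ⟩
    ι P * (1ℚ - p) ^ (n *ₙ e) * ι (suc b)
      ≡⟨ regroup ⟩
    ι (P *ₙ suc b) * ((1ℚ - p) ^ n) ^ e
      ≤⟨ *-monoʳ-≤ (^-nonNeg (^-nonNeg (0≤1-p p≤1) n) e) (ι-mono-≤ (2^n*2^n*b≤2^75^e (suc b) b<n)) ⟩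
    ι ((2 ℕ.^ 75) ℕ.^ e) * ((1ℚ - p) ^ n) ^ e
      ≡⟨ trans (cong (_* ((1ℚ - p) ^ n) ^ e) (ι-^ (2 ℕ.^ 75) e)) (sym (^-distrib-* C ((1ℚ - p) ^ n) e)) ⟩
    (C * (1ℚ - p) ^ n) ^ e
      ≤⟨ ^-≤1 (*-nonNeg (ι-nonNeg _) (^-nonNeg (0≤1-p p≤1) n)) C*[1-p]^n≤1 e ⟩
    1ℚ
      ≡⟨ sym (ℚₚ.*-inverseˡ (ι (suc b))) ⟩
    1/ ι (suc b) * ι (suc b) ∎)
    where
    open ℚₚ.≤-Reasoning
    P : ℕ
    P = 2 ℕ.^ n *ₙ 2 ℕ.^ n
    regroup : ι P * (1ℚ - p) ^ (n *ₙ e) * ι (suc b) ≡ ι (P *ₙ suc b) * ((1ℚ - p) ^ n) ^ e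
    regroup = begin-equality
      ι P * (1ℚ - p) ^ (n *ₙ e) * ι (suc b)  ≡⟨ cong (λ x → ι P * x * ι (suc b)) (sym (^-assocʳ (1ℚ - p) n e)) ⟩
      ι P * ((1ℚ - p) ^ n) ^ e * ι (suc b)
        ≡⟨ solve 3 (λ a x c → a :* x :* c := a :* c :* x) refl (ι P) (((1ℚ - p) ^ n) ^ e) (ι (suc b)) ⟩
      ι P * ι (suc b) * ((1ℚ - p) ^ n) ^ e   ≡⟨ cong (_* ((1ℚ - p) ^ n) ^ e) (sym (ι-* P (suc b))) ⟩
      ι (P *ₙ suc b) * ((1ℚ - p) ^ n) ^ e    ∎
      where open +-*-Solver

five-ninths-ℚ : ∀ δ → 0ℚ ≤ δ → ∀ n L → 5 *ₙ n ≤ₙ 9 *ₙ L → (+ 5 / 9 - δ) * (+ n / 1) ≤ + L / 1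
five-ninths-ℚ δ 0≤δ n L 5n≤9L rewrite /1≡ι n | /1≡ι L = begin
  (+ 5 / 9 - δ) * ι n   ≤⟨ *-monoʳ-≤ (ι-nonNeg n) (p-q≤p 0≤δ) ⟩
  + 5 / 9 * ι n         ≤⟨ *ι-cancel-≤ 8 (begin
                             + 5 / 9 * ι n * ι 9   ≡⟨ solve 1 (λ x → con (+ 5 / 9) :* x :* con (ι 9) := con (ι 5) :* x) refl (ι n) ⟩
                             ι 5 * ι n             ≡⟨ sym (ι-* 5 n) ⟩
                             ι (5 *ₙ n)            ≤⟨ ι-mono-≤ 5n≤9L ⟩
                             ι (9 *ₙ L)            ≡⟨ trans (ι-* 9 L) (ℚₚ.*-comm (ι 9) (ι L)) ⟩
                             ι L * ι 9             ∎) ⟩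
  ι L                   ∎
  where
  open ℚₚ.≤-Reasoning
  open +-*-Solver

many-leaf-tree-whp : ∀ δ → 0ℚ ≤ δ → ∀ ε b → 1/ ι (suc b) ≤ ε → ∀ n → 225 + suc b ≤ₙ n → C ≤ + n / 1 →
                     ProbAtLeast n (C * inv n) (HasManyLeafTree n δ) (1ℚ - ε)
many-leaf-tree-whp δ 0≤δ ε b 1/b≤ε n@(suc _) N≤n C≤n =
  ProbAtLeast-mono {n} many-leaves
                   (-‿antimonoʳ-≤ 1ℚ (ℚₚ.≤-trans (unjoined-bound b (ℕₚ.m+n≤o⇒n≤o 225 N≤n)) 1/b≤ε))
                   (LargeSetsJoinedWhp.largeSetsJoined-whp n k p 0≤p p≤1)
  where
  open EdgeProbability n (subst (C ≤_) (/1≡ι n) C≤n)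
  open Large (ℕₚ.m+n≤o⇒m≤o 225 N≤n)
  many-leaves : ∀ g → Growth.LargeSetsJoined {n} g k → HasManyLeafTree n δ g
  many-leaves g joined =
    let V , t , tree , n<L+2k = Growth.many-leaf-tree {n} g (s≤s z≤n) 3k≤n joined
    in V , t , tree , five-ninths-ℚ δ 0≤δ n (leafCount V t) (five-ninths (leafCount V t) n<L+2k)

1/suc≤ : ∀ ε → 0ℚ < ε → Σ ℕ λ b → 1/ ι (suc b) ≤ ε
1/suc≤ (mkℚ (+ suc a) d _) _ =
  d , *≤* (subst₂ ℤ._≤_ (sym (ℤₚ.+◃n≡+n (1 *ₙ suc d))) (sym (ℤₚ.+◃n≡+n (suc a *ₙ suc d)))
                        (ℤ.+≤+ (ℕₚ.*-monoˡ-≤ (suc d) {1} {suc a} (s≤s z≤n))))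
1/suc≤ (mkℚ (+ 0) d _)     (*<* (ℤ.+<+ ()))
1/suc≤ (mkℚ ℤ.-[1+ a ] d _) (*<* ())

corollary2p3 : (δ : ℚ) → 0ℚ < δ →
    Σ ℚ λ C → 0ℚ < C ×
      ((ε : ℚ) → 0ℚ < ε →
        Σ ℕ λ N → (n : ℕ) → N Data.Nat.≤ n → C ≤ (+ n / 1) →
          ProbAtLeast n (C * inv n) (HasManyLeafTree n δ) (1ℚ - ε))
corollary2p3 δ 0<δ = C , ι-pos (2 ℕ.^ 75 ∸ 1) , λ ε 0<ε →
  let b , 1/b≤ε = 1/suc≤ ε 0<ε in
  225 + suc b , many-leaf-tree-whp δ (ℚₚ.<⇒≤ 0<δ) ε b 1/b≤ε
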